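{- Fix $d\ge1$. For all $n\ge d+3$, $k\ge1$ and $m\ge0$, \[ a_{n,m,k}=a_{n-1,m,k-1}+(m+d)\,a_{n-1,m,k}+(n-m-d)\,a_{n-1,m-1,k}, \] where by convention $a_{n,-1,k}=0$ and $a_{n,m,0}=0$ for $n>0$.
   Context: For $\sigma\in\mathcal S_n$ (permutations of $[n]$), write $\sigma$ in standard cycle form (each cycle begins with its smallest element, cycles ordered left to right by increasing smallest elements) and let $\mathrm{Flatten}(\sigma)=s_1s_2\cdots s_n$ be the word obtained by erasing the parentheses. For $d\ge1$, a (flattened) $d$-descent of $\sigma$ is an index $i\in[n-1]$ with $s_i-s_{i+1}\ge d$. Let $a_{n,m,k}=a_{n,m,k}(d)$ be the number of permutations of $[n]$ having exactly $m$ flattened $d$-descents and exactly $k$ cycles. -}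

module Defs where

open import Data.Nat using (ℕ; zero; suc; _+_; _≤ᵇ_)
open import Data.Fin using (Fin; toℕ)
open import Data.Fin.Properties using () renaming (_≟_ to _≟ᶠ_)
open import Data.Vec using (Vec; lookup; allFin)
open import Data.List using (List; []; _∷_; concatMap; filterᵇ; length; map)
open import Data.Bool.ListAction using (all; any)
open import Data.Bool using (Bool; true; false; if_then_else_; _∧_)
open import Data.Integer using (ℤ; +_; -[1+_])
open import Relation.Nullary.Decidable using (⌊_⌋)
import Data.List as L
import Data.Vec as V

allVecs : (k n : ℕ) → List (Vec (Fin n) k)
allVecs zero    n = V.[] ∷ []
allVecs (suc k) n =
  concatMap (λ x → map (λ v → x V.∷ v) (allVecs k n)) (L.allFin n)

-- A vector v of length n encodes the map σ(i) = lookup v i on Fin n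
-- (Fin n ≅ {0,…,n-1}, i.e. [n] shifted by one).  It is a permutation iff surjective
-- (equivalently bijective, the domain being finite of the same size).
isPerm : {n : ℕ} → Vec (Fin n) n → Bool
isPerm {n} v = all (λ i → any (λ j → ⌊ lookup v j ≟ᶠ i ⌋) (L.allFin n)) (L.allFin n)

perms : (n : ℕ) → List (Vec (Fin n) n)
perms n = filterᵇ isPerm (allVecs n n)

module _ {n : ℕ} (σ : Fin n → Fin n) where

  iter : ℕ → Fin n → Fin n
  iter zero    x = x
  iter (suc j) x = σ (iter j x)

  isCycleMin : Fin n → Bool
  isCycleMin i = all (λ j → toℕ i ≤ᵇ toℕ (iter j i)) (L.upTo n)

  -- the cycle of i written starting from i: i, σ i, σ² i, … (fuel n suffices)
  orbitFrom : Fin n → ℕ → Fin n → List (Fin n)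
  orbitFrom i zero    x = []
  orbitFrom i (suc f) x =
    x ∷ (if ⌊ σ x ≟ᶠ i ⌋ then [] else orbitFrom i f (σ x))

  cycleMins : List (Fin n)
  cycleMins = filterᵇ isCycleMin (L.allFin n)

  -- Flatten(σ): standard cycle form with parentheses erased
  flatten : List ℕ
  flatten = map toℕ (concatMap (λ i → orbitFrom i n i) cycleMins)

  numCycles : ℕ
  numCycles = length cycleMins

dDescents : ℕ → List ℕ → ℕ
dDescents d []           = 0
dDescents d (x ∷ [])     = 0
dDescents d (x ∷ y ∷ ws) =
  (if (y + d) ≤ᵇ x then 1 else 0) + dDescents d (y ∷ ws)

a : (d n m k : ℕ) → ℕ
a d n m k = length (filterᵇ
  (λ v → ⌊ dDescents d (flatten (lookup v)) Data.Nat.≟ m ⌋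
       ∧ ⌊ numCycles (lookup v) Data.Nat.≟ k ⌋)
  (perms n))

aℤ : (d n : ℕ) → ℤ → ℕ → ℤ
aℤ d n (+ m)    k = + a d n m k
aℤ d n -[1+ _ ] k = + 0

-- Removing the largest letter n from a permutation of [n] is a bijection onto pairs (σ, j) of a
-- permutation σ of [n - 1] and a place to put n back: as a new fixed point, or right after j in
-- its cycle. In standard cycle form the first choice appends n to Flatten σ (one more cycle, same
-- d-descents). The second puts n right after j (same cycles); this never destroys a d-descent and
-- creates one exactly when the letter y following j satisfies y + d ≤ n but j - y < d. So the
-- d-descents of σ together with the created ones correspond to the non-initial letters y ≤ n - d
-- of Flatten σ. As Flatten σ starts with 1 there are n - 1 - d of them: if σ has m d-descents,
-- m + d of the n - 1 places j keep m and the other n - 1 - m - d raise it to m + 1.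

module Submission where

module Counting where

  open import Data.Nat using (ℕ; suc; _+_; _≟_)
  open import Data.Nat.Properties using (+-assoc; +-comm; suc-injective)
  open import Data.List using (List; []; _∷_; _++_; map; filterᵇ; length; cartesianProduct)
  open import Data.List.Membership.Propositional using (_∈_)
  open import Data.List.Relation.Unary.Any using (here; there)
  open import Data.List.Relation.Binary.Permutation.Propositional as ↭ using (_↭_)
  open import Data.Bool using (Bool; true; false)
  open import Data.Product using (_×_; _,_)
  open import Function.Base using (_∘_)
  open import Relation.Nullary using (yes; no)
  open import Relation.Nullary.Decidable using (⌊_⌋)
  open import Relation.Nullary.Negation using (contradiction)
  open import Relation.Binary.PropositionalEquality

  private variable
    A B : Set

  indicator : Bool → ℕ
  indicator true = 1
  indicator false = 0

  count : (A → Bool) → List A → ℕ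
  count p [] = 0
  count p (x ∷ xs) = indicator (p x) + count p xs

  sumBy : (A → ℕ) → List A → ℕ
  sumBy f [] = 0
  sumBy f (x ∷ xs) = f x + sumBy f xs

  length-filterᵇ : (p : A → Bool) (xs : List A) → length (filterᵇ p xs) ≡ count p xs
  length-filterᵇ p [] = refl
  length-filterᵇ p (x ∷ xs) with p x
  ... | true = cong suc (length-filterᵇ p xs)
  ... | false = length-filterᵇ p xs

  count-↭ : (p : A → Bool) {xs ys : List A} → xs ↭ ys → count p xs ≡ count p ys
  count-↭ p ↭.refl = refl
  count-↭ p (↭.prep x r) = cong (indicator (p x) +_) (count-↭ p r)
  count-↭ p {x ∷ y ∷ xs} {.y ∷ .x ∷ ys} (↭.swap x y r) = begin
    indicator (p x) + (indicator (p y) + count p xs) ≡⟨ sym (+-assoc (indicator (p x)) _ _) ⟩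
    indicator (p x) + indicator (p y) + count p xs   ≡⟨ cong₂ _+_ (+-comm (indicator (p x)) _) (count-↭ p r) ⟩
    indicator (p y) + indicator (p x) + count p ys   ≡⟨ +-assoc (indicator (p y)) _ _ ⟩
    indicator (p y) + (indicator (p x) + count p ys) ∎
    where open ≡-Reasoning
  count-↭ p (↭.trans r s) = trans (count-↭ p r) (count-↭ p s)

  count-++ : (p : A → Bool) (xs ys : List A) → count p (xs ++ ys) ≡ count p xs + count p ys
  count-++ p [] ys = refl
  count-++ p (x ∷ xs) ys = trans (cong (indicator (p x) +_) (count-++ p xs ys)) (sym (+-assoc (indicator (p x)) _ _))

  count-map : (p : B → Bool) (f : A → B) (xs : List A) → count p (map f xs) ≡ count (λ x → p (f x)) xs
  count-map p f [] = refl
  count-map p f (x ∷ xs) = cong (indicator (p (f x)) +_) (count-map p f xs)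

  count-cartesianProduct : (p : A × B → Bool) (xs : List A) (ys : List B) →
    count p (cartesianProduct xs ys) ≡ sumBy (λ x → count (λ y → p (x , y)) ys) xs
  count-cartesianProduct p [] ys = refl
  count-cartesianProduct p (x ∷ xs) ys =
    trans (count-++ p (map (x ,_) ys) _) (cong₂ _+_ (count-map p (x ,_) ys) (count-cartesianProduct p xs ys))

  count-false : (xs : List A) → count (λ _ → false) xs ≡ 0
  count-false [] = refl
  count-false (x ∷ xs) = count-false xs

  count≡sumBy : (p : A → Bool) (xs : List A) → count p xs ≡ sumBy (λ x → indicator (p x)) xs
  count≡sumBy p [] = refl
  count≡sumBy p (x ∷ xs) = cong (indicator (p x) +_) (count≡sumBy p xs)

  count-cong : (p q : A → Bool) (xs : List A) → (∀ x → x ∈ xs → p x ≡ q x) → count p xs ≡ count q xs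
  count-cong p q [] h = refl
  count-cong p q (x ∷ xs) h = cong₂ _+_ (cong indicator (h x (here refl))) (count-cong p q xs (λ y m → h y (there m)))

  sumBy-cong : (f g : A → ℕ) (xs : List A) → (∀ x → x ∈ xs → f x ≡ g x) → sumBy f xs ≡ sumBy g xs
  sumBy-cong f g [] h = refl
  sumBy-cong f g (x ∷ xs) h = cong₂ _+_ (h x (here refl)) (sumBy-cong f g xs (λ y m → h y (there m)))

  _==_ : ℕ → ℕ → Bool
  m == n = ⌊ m ≟ n ⌋

  ==-refl : ∀ m → (m == m) ≡ true
  ==-refl m with m ≟ m
  ... | yes _ = refl
  ... | no m≢m = contradiction refl m≢m

  ≢⇒==-false : ∀ {m n} → m ≢ n → (m == n) ≡ false
  ≢⇒==-false {m} {n} m≢n with m ≟ n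
  ... | yes m≡n = contradiction m≡n m≢n
  ... | no _ = refl

  ==-suc : ∀ m n → (suc m == suc n) ≡ (m == n)
  ==-suc m n with m ≟ n
  ... | yes refl = ==-refl (suc m)
  ... | no m≢n = ≢⇒==-false (m≢n ∘ suc-injective)



module FinEndomaps where

  open import Data.Nat using (ℕ; zero; suc)
  open import Data.Nat.Properties using (n≮n)
  open import Data.Fin using (Fin; inject₁; fromℕ; punchOut)
  open import Data.Fin.Properties using (_≟_; fromℕ≢inject₁; any?; injective⇒≤; punchOut-injective)
  open import Data.Product using (∃; _,_; proj₁; proj₂)
  open import Data.Sum using (_⊎_; inj₁; inj₂)
  open import Relation.Nullary using (yes; no)
  open import Relation.Nullary.Negation using (contradiction)
  open import Relation.Binary.PropositionalEquality

  Surj : ∀ {n} → (Fin n → Fin n) → Set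
  Surj {n} f = ∀ (z : Fin n) → ∃ λ y → f y ≡ z

  Inj : ∀ {n} → (Fin n → Fin n) → Set
  Inj f = ∀ {x y} → f x ≡ f y → x ≡ y

  inj⇒surj : ∀ {n} (g : Fin n → Fin n) → Inj g → Surj g
  inj⇒surj {suc n} g g-inj a with any? (λ b → g b ≟ a)
  ... | yes hit = hit
  ... | no miss = contradiction (injective⇒≤ {f = punch} punch-injective) (n≮n n)
    where
    punch : Fin (suc n) → Fin n
    punch b = punchOut {i = a} {j = g b} (λ e → miss (b , sym e))
    punch-injective : ∀ {b c} → punch b ≡ punch c → b ≡ c
    punch-injective {b} {c} e = g-inj (punchOut-injective (λ e′ → miss (b , sym e′)) (λ e′ → miss (c , sym e′)) e)

  -- A right inverse g of f is injective, hence surjective, hence also a left inverse.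
  surj⇒inj : ∀ {n} (f : Fin n → Fin n) → Surj f → Inj f
  surj⇒inj {n} f f-surj {x} {y} fx≡fy = trans (sym (g∘f x)) (trans (cong g fx≡fy) (g∘f y))
    where
    g : Fin n → Fin n
    g z = proj₁ (f-surj z)
    f∘g : ∀ z → f (g z) ≡ z
    f∘g z = proj₂ (f-surj z)
    g∘f : ∀ x → g (f x) ≡ x
    g∘f x with inj⇒surj g (λ e → trans (sym (f∘g _)) (trans (cong f e) (f∘g _))) x
    ... | a , refl = cong g (f∘g a)

  data LastView {n : ℕ} : Fin (suc n) → Set where
    injected : (x : Fin n) → LastView (inject₁ x)
    last     : LastView (fromℕ n)

  lastView : ∀ {n} (i : Fin (suc n)) → LastView i
  lastView {zero} Fin.zero = last
  lastView {suc n} Fin.zero = injected Fin.zero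
  lastView {suc n} (Fin.suc i) with lastView i
  ... | injected x = injected (Fin.suc x)
  ... | last = last

  lastView-inject₁ : ∀ {n} (x : Fin n) → lastView (inject₁ x) ≡ injected x
  lastView-inject₁ {suc n} Fin.zero = refl
  lastView-inject₁ {suc n} (Fin.suc x) rewrite lastView-inject₁ x = refl

  lastView-fromℕ : ∀ n → lastView (fromℕ n) ≡ last
  lastView-fromℕ zero = refl
  lastView-fromℕ (suc n) rewrite lastView-fromℕ n = refl

  inject₁-or-fromℕ : ∀ {n} (i : Fin (suc n)) → (∃ λ y → i ≡ inject₁ y) ⊎ (i ≡ fromℕ n)
  inject₁-or-fromℕ i with lastView i
  ... | injected y = inj₁ (y , refl)
  ... | last = inj₂ refl

  inject₁≢fromℕ : ∀ {n} (x : Fin n) → inject₁ x ≢ fromℕ n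
  inject₁≢fromℕ x e = fromℕ≢inject₁ (sym e)

  lowerOr : ∀ {n} → Fin (suc n) → Fin n → Fin n
  lowerOr i d with lastView i
  ... | injected z = z
  ... | last = d

  lowerOr-inject₁ : ∀ {n} (z d : Fin n) → lowerOr (inject₁ z) d ≡ z
  lowerOr-inject₁ z d rewrite lastView-inject₁ z = refl

  lowerOr-fromℕ : ∀ {n} (d : Fin n) → lowerOr (fromℕ n) d ≡ d
  lowerOr-fromℕ {n} d rewrite lastView-fromℕ n = refl

  inject₁-lowerOr : ∀ {n} (i : Fin (suc n)) d → i ≢ fromℕ n → inject₁ (lowerOr i d) ≡ i
  inject₁-lowerOr i d i≢last with lastView i
  ... | injected z = refl
  ... | last = contradiction refl i≢last


module Insertion where

  open FinEndomaps
  open import Data.Nat using (ℕ; suc)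
  open import Data.Fin using (Fin; inject₁; fromℕ)
  open import Data.Fin.Properties using (_≟_; any?; inject₁-injective)
  open import Data.Product using (∃; _×_; _,_; proj₁; proj₂)
  open import Data.Sum using (_⊎_; inj₁; inj₂)
  open import Relation.Nullary using (yes; no)
  open import Relation.Nullary.Negation using (contradiction)
  open import Relation.Binary.PropositionalEquality

  -- insert σ j adds the new point fromℕ n to σ: right after inject₁ x in its cycle when
  -- j = inject₁ x, and as a new fixed point when j = fromℕ n.
  module Insert {n : ℕ} (σ : Fin n → Fin n) where

    insertView : ∀ {j} → LastView {n} j → ∀ {i} → LastView {n} i → Fin (suc n)
    insertView (injected x) (injected y) with y ≟ x
    ... | yes _ = fromℕ n
    ... | no _ = inject₁ (σ y)
    insertView (injected x) last = inject₁ (σ x)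
    insertView last (injected y) = inject₁ (σ y)
    insertView last last = fromℕ n

    insert : Fin (suc n) → Fin (suc n) → Fin (suc n)
    insert j i = insertView (lastView j) (lastView i)

    insertAfter-self : ∀ x → insert (inject₁ x) (inject₁ x) ≡ fromℕ n
    insertAfter-self x rewrite lastView-inject₁ x with x ≟ x
    ... | yes _ = refl
    ... | no x≢x = contradiction refl x≢x

    insertAfter-other : ∀ x y → y ≢ x → insert (inject₁ x) (inject₁ y) ≡ inject₁ (σ y)
    insertAfter-other x y y≢x rewrite lastView-inject₁ x | lastView-inject₁ y with y ≟ x
    ... | yes y≡x = contradiction y≡x y≢x
    ... | no _ = refl

    insertAfter-new : ∀ x → insert (inject₁ x) (fromℕ n) ≡ inject₁ (σ x)
    insertAfter-new x rewrite lastView-inject₁ x | lastView-fromℕ n = refl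

    insertFixed-old : ∀ y → insert (fromℕ n) (inject₁ y) ≡ inject₁ (σ y)
    insertFixed-old y rewrite lastView-inject₁ y | lastView-fromℕ n = refl

    insertFixed-new : insert (fromℕ n) (fromℕ n) ≡ fromℕ n
    insertFixed-new rewrite lastView-fromℕ n = refl

    insert-self : ∀ j → insert j j ≡ fromℕ n
    insert-self j with inject₁-or-fromℕ j
    ... | inj₁ (x , refl) = insertAfter-self x
    ... | inj₂ refl = insertFixed-new

    insert≡new⇒≡ : ∀ j i → insert j i ≡ fromℕ n → i ≡ j
    insert≡new⇒≡ j i e with inject₁-or-fromℕ j | inject₁-or-fromℕ i
    ... | inj₂ refl | inj₂ refl = refl
    ... | inj₂ refl | inj₁ (y , refl) = contradiction (trans (sym (insertFixed-old y)) e) (inject₁≢fromℕ _)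
    ... | inj₁ (x , refl) | inj₂ refl = contradiction (trans (sym (insertAfter-new x)) e) (inject₁≢fromℕ _)
    ... | inj₁ (x , refl) | inj₁ (y , refl) with y ≟ x
    ...   | yes refl = refl
    ...   | no y≢x = contradiction (trans (sym (insertAfter-other x y y≢x)) e) (inject₁≢fromℕ _)

    insert-surj : Surj σ → ∀ j → Surj (insert j)
    insert-surj σ-surj j t with inject₁-or-fromℕ j | inject₁-or-fromℕ t
    ... | _ | inj₂ refl = j , insert-self j
    ... | inj₂ refl | inj₁ (z , refl) = inject₁ y , trans (insertFixed-old y) (cong inject₁ σy≡z)
      where y = proj₁ (σ-surj z); σy≡z = proj₂ (σ-surj z)
    ... | inj₁ (x , refl) | inj₁ (z , refl) with proj₁ (σ-surj z) ≟ x
    ...   | yes refl = fromℕ n , trans (insertAfter-new x) (cong inject₁ (proj₂ (σ-surj z)))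
    ...   | no y≢x = inject₁ _ , trans (insertAfter-other x _ y≢x) (cong inject₁ (proj₂ (σ-surj z)))

  open Insert public using (insert)

  insert-cong : ∀ {n} {σ σ′ : Fin n → Fin n} → (∀ x → σ x ≡ σ′ x) → ∀ j i → insert σ j i ≡ insert σ′ j i
  insert-cong {n} {σ} {σ′} e j i with inject₁-or-fromℕ j | inject₁-or-fromℕ i
  ... | inj₂ refl | inj₂ refl = trans (Insert.insertFixed-new σ) (sym (Insert.insertFixed-new σ′))
  ... | inj₂ refl | inj₁ (y , refl) = trans (Insert.insertFixed-old σ y) (trans (cong inject₁ (e y)) (sym (Insert.insertFixed-old σ′ y)))
  ... | inj₁ (x , refl) | inj₂ refl = trans (Insert.insertAfter-new σ x) (trans (cong inject₁ (e x)) (sym (Insert.insertAfter-new σ′ x)))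
  ... | inj₁ (x , refl) | inj₁ (y , refl) with y ≟ x
  ...   | yes refl = trans (Insert.insertAfter-self σ x) (sym (Insert.insertAfter-self σ′ x))
  ...   | no y≢x = trans (Insert.insertAfter-other σ x y y≢x) (trans (cong inject₁ (e y)) (sym (Insert.insertAfter-other σ′ x y y≢x)))

  -- The inverse of insertion: drop fromℕ n from the cycle of τ, remembering its predecessor.
  module RemoveMax {n : ℕ} (τ : Fin (suc n) → Fin (suc n)) where

    removalPoint : Fin (suc n)
    removalPoint with any? (λ y → τ (inject₁ y) ≟ fromℕ n)
    ... | yes (y , _) = inject₁ y
    ... | no _ = fromℕ n

    removeMax : Fin n → Fin n
    removeMax y = lowerOr (τ (inject₁ y)) (lowerOr (τ (fromℕ n)) y)

    removalPoint-spec : (∃ λ x → removalPoint ≡ inject₁ x × τ (inject₁ x) ≡ fromℕ n)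
                      ⊎ (removalPoint ≡ fromℕ n × ∀ y → τ (inject₁ y) ≢ fromℕ n)
    removalPoint-spec with any? (λ y → τ (inject₁ y) ≟ fromℕ n)
    ... | yes (y , e) = inj₁ (y , refl , e)
    ... | no none = inj₂ (refl , λ y e → none (y , e))

    module _ (τ-surj : Surj τ) where

      private
        τ-inj : Inj τ
        τ-inj = surj⇒inj τ τ-surj

      open Insert removeMax using (insertAfter-self; insertAfter-other; insertAfter-new; insertFixed-old; insertFixed-new)

      insert-removeMax : ∀ i → insert removeMax removalPoint i ≡ τ i
      insert-removeMax i with removalPoint-spec
      insert-removeMax i | inj₁ (x , ej , τx≡new) rewrite ej with inject₁-or-fromℕ i
      ... | inj₂ refl = begin
        insert removeMax (inject₁ x) (fromℕ n)
          ≡⟨ insertAfter-new x ⟩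
        inject₁ (removeMax x)
          ≡⟨ cong (λ w → inject₁ (lowerOr w (lowerOr (τ (fromℕ n)) x))) τx≡new ⟩
        inject₁ (lowerOr (fromℕ n) (lowerOr (τ (fromℕ n)) x))
          ≡⟨ cong inject₁ (lowerOr-fromℕ _) ⟩
        inject₁ (lowerOr (τ (fromℕ n)) x)
          ≡⟨ inject₁-lowerOr (τ (fromℕ n)) x (λ e → inject₁≢fromℕ x (τ-inj (trans τx≡new (sym e)))) ⟩
        τ (fromℕ n) ∎
        where open ≡-Reasoning
      ... | inj₁ (y , refl) with y ≟ x
      ...   | yes refl = trans (insertAfter-self x) (sym τx≡new)
      ...   | no y≢x = trans (insertAfter-other x y y≢x)
                         (inject₁-lowerOr (τ (inject₁ y)) _ λ e → y≢x (inject₁-injective (τ-inj (trans e (sym τx≡new)))))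
      insert-removeMax i | inj₂ (ej , none) rewrite ej with inject₁-or-fromℕ i
      ... | inj₁ (y , refl) = trans (insertFixed-old y) (inject₁-lowerOr (τ (inject₁ y)) _ (none y))
      ... | inj₂ refl with τ-surj (fromℕ n)
      ...   | w , τw≡new with inject₁-or-fromℕ w
      ...     | inj₁ (y , refl) = contradiction τw≡new (none y)
      ...     | inj₂ refl = trans insertFixed-new (sym τw≡new)

      removeMax-surj : Surj removeMax
      removeMax-surj z with τ-surj (inject₁ z)
      ... | i , τi≡z with inject₁-or-fromℕ i
      ...   | inj₁ (y , refl) = y , trans (cong (λ w → lowerOr w (lowerOr (τ (fromℕ n)) y)) τi≡z) (lowerOr-inject₁ z _)
      ...   | inj₂ refl with τ-surj (fromℕ n)
      ...     | w , τw≡new with inject₁-or-fromℕ w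
      ...       | inj₂ refl = contradiction (trans (sym τi≡z) τw≡new) (inject₁≢fromℕ z)
      ...       | inj₁ (x , refl) = x , (begin
        lowerOr (τ (inject₁ x)) (lowerOr (τ (fromℕ n)) x) ≡⟨ cong (λ u → lowerOr u (lowerOr (τ (fromℕ n)) x)) τw≡new ⟩
        lowerOr (fromℕ n) (lowerOr (τ (fromℕ n)) x)       ≡⟨ lowerOr-fromℕ _ ⟩
        lowerOr (τ (fromℕ n)) x                           ≡⟨ cong (λ u → lowerOr u x) τi≡z ⟩
        lowerOr (inject₁ z) x                             ≡⟨ lowerOr-inject₁ z x ⟩
        z                                                 ∎)
        where open ≡-Reasoning

  module _ {n : ℕ} (σ : Fin n → Fin n) (j : Fin (suc n)) where
    open Insert σ using (insertAfter-self; insertAfter-other; insertAfter-new; insertFixed-old)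

    removeMax-insert : ∀ y → RemoveMax.removeMax (insert σ j) y ≡ σ y
    removeMax-insert y with inject₁-or-fromℕ j
    ... | inj₂ refl = trans (cong (λ w → lowerOr w (lowerOr (insert σ (fromℕ n) (fromℕ n)) y)) (insertFixed-old y)) (lowerOr-inject₁ _ _)
    ... | inj₁ (x , refl) with y ≟ x
    ...   | no y≢x = trans (cong (λ w → lowerOr w (lowerOr (insert σ (inject₁ x) (fromℕ n)) y)) (insertAfter-other x y y≢x)) (lowerOr-inject₁ _ _)
    ...   | yes refl = begin
      lowerOr (insert σ (inject₁ x) (inject₁ x)) (lowerOr (insert σ (inject₁ x) (fromℕ n)) x)
        ≡⟨ cong (λ w → lowerOr w (lowerOr (insert σ (inject₁ x) (fromℕ n)) x)) (insertAfter-self x) ⟩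
      lowerOr (fromℕ n) (lowerOr (insert σ (inject₁ x) (fromℕ n)) x)
        ≡⟨ lowerOr-fromℕ _ ⟩
      lowerOr (insert σ (inject₁ x) (fromℕ n)) x
        ≡⟨ cong (λ w → lowerOr w x) (insertAfter-new x) ⟩
      lowerOr (inject₁ (σ x)) x
        ≡⟨ lowerOr-inject₁ _ _ ⟩
      σ x ∎
      where open ≡-Reasoning


module PermutationEnumeration where

  open import Defs
  open FinEndomaps
  open Insertion
  open import Data.Nat using (zero; suc)
  open import Data.Fin using (Fin; inject₁; fromℕ)
  open import Data.Vec as V using (Vec; lookup; tabulate)
  open import Data.Vec.Properties using (lookup∘tabulate; tabulate∘lookup; tabulate-cong; ∷-injectiveʳ)
  open import Data.List as L using (List; []; _∷_; map; concatMap; cartesianProduct)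
  open import Data.List.Membership.Propositional using (_∈_; find)
  open import Data.List.Membership.Propositional.Properties
    using (∈-++⁻; ∈-concatMap⁺; ∈-map⁻; ∈-map⁺; ∈-allFin; ∈-cartesianProduct⁺; ∈-cartesianProduct⁻; ∈-filter⁺; ∈-filter⁻)
  open import Data.List.Membership.Propositional.Properties.WithK using (unique∧set⇒bag)
  open import Data.List.Relation.Unary.Any as Any using (here; there)
  open import Data.List.Relation.Unary.Any.Properties using (any⁺; any⁻)
  open import Data.List.Relation.Unary.All as All using ([])
  open import Data.List.Relation.Unary.All.Properties using (all⁺; all⁻)
  open import Data.List.Relation.Unary.Unique.Propositional using (Unique)
  import Data.List.Relation.Unary.Unique.Propositional.Properties as Unique
  open import Data.List.Relation.Binary.Permutation.Propositional using (_↭_)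
  open import Data.List.Relation.Binary.BagAndSetEquality using (∼bag⇒↭)
  open import Data.Product using (_×_; _,_; proj₁; proj₂)
  open import Data.Sum using (inj₁; inj₂)
  open import Function.Bundles using (mk⇔)
  open import Relation.Nullary.Decidable using (T?; toWitness; fromWitness)
  open import Relation.Binary.PropositionalEquality

  private
    head-∈-map-∷ : ∀ {k n} (vs : List (Vec (Fin n) k)) x {w} → w ∈ map (x V.∷_) vs → V.head w ≡ x
    head-∈-map-∷ (v ∷ vs) x (here refl) = refl
    head-∈-map-∷ (v ∷ vs) x (there m) = head-∈-map-∷ vs x m

    head-∈-concatMap-∷ : ∀ {k n} (vs : List (Vec (Fin n) k)) (xs : List (Fin n)) {w} →
      w ∈ concatMap (λ x → map (x V.∷_) vs) xs → V.head w ∈ xs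
    head-∈-concatMap-∷ vs (x ∷ xs) m with ∈-++⁻ (map (x V.∷_) vs) m
    ... | inj₁ m′ = here (head-∈-map-∷ vs x m′)
    ... | inj₂ m′ = there (head-∈-concatMap-∷ vs xs m′)

    unique-concatMap-∷ : ∀ {k n} (vs : List (Vec (Fin n) k)) (xs : List (Fin n)) → Unique vs → Unique xs →
      Unique (concatMap (λ x → map (x V.∷_) vs) xs)
    unique-concatMap-∷ vs [] _ _ = Unique.[]
    unique-concatMap-∷ vs (x ∷ xs) vs! (x∉xs Unique.∷ xs!) =
      Unique.++⁺ (Unique.map⁺ ∷-injectiveʳ vs!) (unique-concatMap-∷ vs xs vs! xs!)
        (λ (m₁ , m₂) → All.lookup x∉xs (subst (_∈ xs) (head-∈-map-∷ vs x m₁) (head-∈-concatMap-∷ vs xs m₂)) refl)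

  allVecs-unique : ∀ k n → Unique (allVecs k n)
  allVecs-unique zero n = [] Unique.∷ Unique.[]
  allVecs-unique (suc k) n = unique-concatMap-∷ (allVecs k n) (L.allFin n) (allVecs-unique k n) (Unique.allFin⁺ n)

  ∈-allVecs : ∀ {k n} (v : Vec (Fin n) k) → v ∈ allVecs k n
  ∈-allVecs V.[] = here refl
  ∈-allVecs {suc k} {n} (x V.∷ v) =
    ∈-concatMap⁺ (λ x → map (x V.∷_) (allVecs k n)) (Any.map (λ {refl → ∈-map⁺ (x V.∷_) (∈-allVecs v)}) (∈-allFin x))

  ∈perms⁻ : ∀ {n} {v : Vec (Fin n) n} → v ∈ perms n → Surj (lookup v)
  ∈perms⁻ {n} {v} v∈perms z =
    let j , _ , hit = find (any⁻ _ (L.allFin n) (All.lookup (all⁺ _ (L.allFin n) isPerm-v) (∈-allFin z)))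
    in j , toWitness hit
    where isPerm-v = proj₂ (∈-filter⁻ (λ w → T? (isPerm w)) {xs = allVecs n n} v∈perms)

  ∈perms⁺ : ∀ {n} {v : Vec (Fin n) n} → Surj (lookup v) → v ∈ perms n
  ∈perms⁺ {n} {v} v-surj = ∈-filter⁺ (λ w → T? (isPerm w)) (∈-allVecs v) (all⁻ _ (All.tabulate hit))
    where
    hit : ∀ {z} → z ∈ L.allFin n → _
    hit {z} _ = any⁺ _ (Any.map (λ {refl → fromWitness (proj₂ (v-surj z))}) (∈-allFin (proj₁ (v-surj z))))

  perms-unique : ∀ n → Unique (perms n)
  perms-unique n = Unique.filter⁺ _ (allVecs-unique n n)

  Surj-cong : ∀ {n} {f g : Fin n → Fin n} → (∀ x → f x ≡ g x) → Surj f → Surj g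
  Surj-cong e f-surj z = proj₁ (f-surj z) , trans (sym (e _)) (proj₂ (f-surj z))

  insertVec : ∀ {n} → Vec (Fin n) n × Fin (suc n) → Vec (Fin (suc n)) (suc n)
  insertVec (v , j) = tabulate (insert (lookup v) j)

  insertVec-injective : ∀ {n} {p q : Vec (Fin n) n × Fin (suc n)} → insertVec p ≡ insertVec q → p ≡ q
  insertVec-injective {n} {v , j} {v′ , j′} e = cong₂ _,_ v≡v′ j≡j′
    where
    pointwise : ∀ i → insert (lookup v) j i ≡ insert (lookup v′) j′ i
    pointwise i = trans (sym (lookup∘tabulate (insert (lookup v) j) i))
                        (trans (cong (λ w → lookup w i) e) (lookup∘tabulate (insert (lookup v′) j′) i))
    j≡j′ : j ≡ j′
    j≡j′ = Insert.insert≡new⇒≡ (lookup v′) j′ j (trans (sym (pointwise j)) (Insert.insert-self (lookup v) j))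
    v≡v′ : v ≡ v′
    v≡v′ = begin
      v
        ≡⟨ tabulate∘lookup v ⟨
      tabulate (lookup v)
        ≡⟨ tabulate-cong (removeMax-insert (lookup v) j) ⟨
      tabulate (RemoveMax.removeMax (insert (lookup v) j))
        ≡⟨ tabulate-cong (λ y → cong₂ (λ a b → lowerOr a (lowerOr b y)) (pointwise (inject₁ y)) (pointwise (fromℕ n))) ⟩
      tabulate (RemoveMax.removeMax (insert (lookup v′) j′))
        ≡⟨ tabulate-cong (removeMax-insert (lookup v′) j′) ⟩
      tabulate (lookup v′)
        ≡⟨ tabulate∘lookup v′ ⟩
      v′ ∎
      where open ≡-Reasoning

  perms-suc-↭ : ∀ n → perms (suc n) ↭ map insertVec (cartesianProduct (perms n) (L.allFin (suc n)))
  perms-suc-↭ n = ∼bag⇒↭ (unique∧set⇒bag (perms-unique (suc n))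
    (Unique.map⁺ insertVec-injective (Unique.cartesianProduct⁺ (perms-unique n) (Unique.allFin⁺ (suc n))))
    (mk⇔ to from))
    where
    to : ∀ {z} → z ∈ perms (suc n) → z ∈ map insertVec (cartesianProduct (perms n) (L.allFin (suc n)))
    to {z} z∈perms = subst (_∈ _) insertVec-removed (∈-map⁺ insertVec (∈-cartesianProduct⁺ removed∈perms (∈-allFin _)))
      where
      open RemoveMax (lookup z)
      removed = tabulate removeMax
      removed∈perms : removed ∈ perms n
      removed∈perms = ∈perms⁺ (Surj-cong (λ y → sym (lookup∘tabulate removeMax y)) (removeMax-surj (∈perms⁻ z∈perms)))
      insertVec-removed : insertVec (removed , removalPoint) ≡ z
      insertVec-removed = trans (tabulate-cong (λ i → trans (insert-cong (lookup∘tabulate removeMax) removalPoint i)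
                                                             (insert-removeMax (∈perms⁻ z∈perms) i)))
                                (tabulate∘lookup z)
    from : ∀ {z} → z ∈ map insertVec (cartesianProduct (perms n) (L.allFin (suc n))) → z ∈ perms (suc n)
    from m with ∈-map⁻ insertVec m
    ... | (v , j) , vj∈ , refl = ∈perms⁺ (Surj-cong (λ i → sym (lookup∘tabulate (insert (lookup v) j) i))
            (Insert.insert-surj (lookup v) (∈perms⁻ (proj₁ (∈-cartesianProduct⁻ (perms n) (L.allFin (suc n)) vj∈))) j))


module ProfileCount where

  open import Defs
  open Insertion
  open Counting
  open PermutationEnumeration
  open import Data.Nat using (ℕ; zero; suc; _≟_; _≤ᵇ_)
  open import Data.Fin using (Fin; toℕ)
  open import Data.Fin.Properties using () renaming (_≟_ to _≟ᶠ_)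
  open import Data.Vec using (lookup)
  open import Data.Vec.Properties using (lookup∘tabulate)
  open import Data.List as L using (List; []; _∷_; map; concatMap; filterᵇ; length; cartesianProduct)
  open import Data.List.Properties using (map-cong)
  open import Data.Bool using (Bool; true; false; _∧_; if_then_else_)
  open import Data.Bool.ListAction using (all)
  open import Data.Product using (_,_)
  open import Relation.Nullary.Decidable using (⌊_⌋)
  open import Relation.Binary.PropositionalEquality

  private
    variable A : Set

    all-cong : (p q : A → Bool) (xs : List A) → (∀ x → p x ≡ q x) → all p xs ≡ all q xs
    all-cong p q [] h = refl
    all-cong p q (x ∷ xs) h = cong₂ _∧_ (h x) (all-cong p q xs h)

    filterᵇ-cong : (p q : A → Bool) (xs : List A) → (∀ x → p x ≡ q x) → filterᵇ p xs ≡ filterᵇ q xs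
    filterᵇ-cong p q [] h = refl
    filterᵇ-cong p q (x ∷ xs) h with p x | q x | h x
    ... | true | true | _ = cong (x ∷_) (filterᵇ-cong p q xs h)
    ... | false | false | _ = filterᵇ-cong p q xs h

  module _ {n : ℕ} {σ σ′ : Fin n → Fin n} (σ≗σ′ : ∀ x → σ x ≡ σ′ x) where

    iter-cong : ∀ j x → iter σ j x ≡ iter σ′ j x
    iter-cong zero x = refl
    iter-cong (suc j) x = trans (cong σ (iter-cong j x)) (σ≗σ′ _)

    orbitFrom-cong : ∀ i f x → orbitFrom σ i f x ≡ orbitFrom σ′ i f x
    orbitFrom-cong i zero x = refl
    orbitFrom-cong i (suc f) x rewrite σ≗σ′ x =
      cong (λ w → x ∷ (if ⌊ σ′ x ≟ᶠ i ⌋ then [] else w)) (orbitFrom-cong i f (σ′ x))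

    cycleMins-cong : cycleMins σ ≡ cycleMins σ′
    cycleMins-cong = filterᵇ-cong _ _ (L.allFin n)
      (λ i → all-cong _ _ (L.upTo n) (λ j → cong (λ w → toℕ i ≤ᵇ toℕ w) (iter-cong j i)))

    flatten-cong : flatten σ ≡ flatten σ′
    flatten-cong = cong (map toℕ) (trans (cong (concatMap (λ i → orbitFrom σ i n i)) cycleMins-cong)
                                         (cong L.concat (map-cong (λ i → orbitFrom-cong i n i) (cycleMins σ′))))

    numCycles-cong : numCycles σ ≡ numCycles σ′
    numCycles-cong = cong length cycleMins-cong

  hasProfile : ∀ {n} (d m k : ℕ) → (Fin n → Fin n) → Bool
  hasProfile d m k τ = ⌊ dDescents d (flatten τ) ≟ m ⌋ ∧ ⌊ numCycles τ ≟ k ⌋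

  hasProfile-cong : ∀ {n} d m k {σ σ′ : Fin n → Fin n} → (∀ x → σ x ≡ σ′ x) → hasProfile d m k σ ≡ hasProfile d m k σ′
  hasProfile-cong d m k e = cong₂ (λ w c → ⌊ dDescents d w ≟ m ⌋ ∧ ⌊ c ≟ k ⌋) (flatten-cong e) (numCycles-cong e)

  a≡count : ∀ d n m k → a d n m k ≡ count (λ v → hasProfile d m k (lookup v)) (perms n)
  a≡count d n m k = length-filterᵇ _ (perms n)

  a-suc≡sum-insert : ∀ d n m k →
    a d (suc n) m k ≡ sumBy (λ v → count (λ j → hasProfile d m k (insert (lookup v) j)) (L.allFin (suc n))) (perms n)
  a-suc≡sum-insert d n m k = begin
    a d (suc n) m k
      ≡⟨ a≡count d (suc n) m k ⟩
    count (λ v → hasProfile d m k (lookup v)) (perms (suc n))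
      ≡⟨ count-↭ _ (perms-suc-↭ n) ⟩
    count (λ v → hasProfile d m k (lookup v)) (map insertVec (cartesianProduct (perms n) (L.allFin (suc n))))
      ≡⟨ count-map (λ v → hasProfile d m k (lookup v)) insertVec (cartesianProduct (perms n) (L.allFin (suc n))) ⟩
    count (λ vj → hasProfile d m k (lookup (insertVec vj))) (cartesianProduct (perms n) (L.allFin (suc n)))
      ≡⟨ count-cartesianProduct _ (perms n) (L.allFin (suc n)) ⟩
    sumBy (λ v → count (λ j → hasProfile d m k (lookup (insertVec (v , j)))) (L.allFin (suc n))) (perms n)
      ≡⟨ sumBy-cong _ _ (perms n) (λ v _ → count-cong _ _ (L.allFin (suc n))
           (λ j _ → hasProfile-cong d m k (lookup∘tabulate (insert (lookup v) j)))) ⟩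
    sumBy (λ v → count (λ j → hasProfile d m k (insert (lookup v) j)) (L.allFin (suc n))) (perms n) ∎
    where open ≡-Reasoning


module Orbits where

  open import Defs
  open FinEndomaps
  open import Data.Nat using (ℕ; zero; suc; _+_; _∸_; _*_; _≤_; _<_; _≤ᵇ_; NonZero)
  open import Data.Nat.Properties
    using (+-comm; *-suc; ≤-pred; ≤-trans; <⇒≤; <-≤-trans; n<1+n; m<n⇒0<n∸m; m∸n≤m; m+[n∸m]≡n; ≤ᵇ⇒≤; ≤⇒≤ᵇ)
  open import Data.Nat.DivMod using (_%_; _/_; m≡m%n+[m/n]*n; m%n<n)
  open import Data.Fin using (Fin; toℕ)
  open import Data.Fin.Properties using (_≟_; pigeonhole; toℕ<n)
  open import Data.List as L using ([]; _∷_)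
  open import Data.List.Membership.Propositional.Properties using (∈-upTo⁺)
  open import Data.List.Relation.Unary.All as All using ()
  open import Data.List.Relation.Unary.All.Properties using (all⁺; all⁻)
  open import Data.Bool using (T)
  open import Data.Product using (∃; _×_; _,_)
  open import Relation.Nullary using (yes; no)
  open import Relation.Nullary.Negation using (contradiction)
  open import Relation.Binary.PropositionalEquality

  module Iterate {N : ℕ} (τ : Fin N → Fin N) where

    iterate : ℕ → Fin N → Fin N
    iterate = iter τ

    iterate-+ : ∀ a b x → iterate (a + b) x ≡ iterate a (iterate b x)
    iterate-+ zero b x = refl
    iterate-+ (suc a) b x = cong τ (iterate-+ a b x)

    iterate-suc : ∀ a x → iterate (suc a) x ≡ iterate a (τ x)
    iterate-suc a x = trans (cong (λ t → iterate t x) (+-comm 1 a)) (iterate-+ a 1 x)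

    _↝_ : Fin N → Fin N → Set
    x ↝ z = ∃ λ t → iterate t x ≡ z

    ↝-refl : ∀ {x} → x ↝ x
    ↝-refl = 0 , refl

    ↝-step : ∀ {x y} → x ↝ y → x ↝ τ y
    ↝-step (t , e) = suc t , cong τ e

    ↝-trans : ∀ {x y z} → x ↝ y → y ↝ z → x ↝ z
    ↝-trans (t , refl) (s , refl) = s + t , iterate-+ s t _

    ReturnsWithin : Fin N → ℕ → Fin N → Set
    ReturnsWithin i f y = ∃ λ s → s < f × iterate (suc s) y ≡ i

    returnsWithin-step : ∀ {i f y} → ReturnsWithin i (suc f) y → τ y ≢ i → ReturnsWithin i f (τ y)
    returnsWithin-step (zero , _ , τy≡i) τy≢i = contradiction τy≡i τy≢i
    returnsWithin-step {y = y} (suc s , s<f , hit) _ = s , ≤-pred s<f , trans (sym (iterate-suc (suc s) y)) hit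

    orbitFrom-stop : ∀ {i f y} → τ y ≡ i → orbitFrom τ i (suc f) y ≡ y ∷ []
    orbitFrom-stop {i} {f} {y} τy≡i with τ y ≟ i
    ... | yes _ = refl
    ... | no τy≢i = contradiction τy≡i τy≢i

    orbitFrom-step : ∀ {i f y} → τ y ≢ i → orbitFrom τ i (suc f) y ≡ y ∷ orbitFrom τ i f (τ y)
    orbitFrom-step {i} {f} {y} τy≢i with τ y ≟ i
    ... | yes τy≡i = contradiction τy≡i τy≢i
    ... | no _ = refl

    orbitFrom-extraFuel : ∀ i f y e → ReturnsWithin i f y → orbitFrom τ i (f + e) y ≡ orbitFrom τ i f y
    orbitFrom-extraFuel i (suc f) y e r with τ y ≟ i
    ... | yes _ = refl
    ... | no τy≢i = cong (y ∷_) (orbitFrom-extraFuel i f (τ y) e (returnsWithin-step r τy≢i))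

    module Bijective (τ-surj : Surj τ) where

      iterate-injective : ∀ a {x y} → iterate a x ≡ iterate a y → x ≡ y
      iterate-injective zero e = e
      iterate-injective (suc a) e = iterate-injective a (surj⇒inj τ τ-surj e)

      period : ∀ i → ∃ λ p → 1 ≤ p × p ≤ N × iterate p i ≡ i
      period i with pigeonhole (n<1+n N) (λ (t : Fin (suc N)) → iterate (toℕ t) i)
      ... | u , v , u<v , e = toℕ v ∸ toℕ u , m<n⇒0<n∸m u<v , ≤-trans (m∸n≤m (toℕ v) (toℕ u)) (≤-pred (toℕ<n v)) ,
                               iterate-injective (toℕ u) (begin
        iterate (toℕ u) (iterate (toℕ v ∸ toℕ u) i) ≡⟨ iterate-+ (toℕ u) _ i ⟨
        iterate (toℕ u + (toℕ v ∸ toℕ u)) i         ≡⟨ cong (λ w → iterate w i) (m+[n∸m]≡n (<⇒≤ u<v)) ⟩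
        iterate (toℕ v) i                           ≡⟨ e ⟨
        iterate (toℕ u) i                           ∎)
        where open ≡-Reasoning

      iterate-* : ∀ {p x} → iterate p x ≡ x → ∀ c → iterate (c * p) x ≡ x
      iterate-* e zero = refl
      iterate-* {p} {x} e (suc c) = trans (iterate-+ p (c * p) x) (trans (cong (iterate p) (iterate-* e c)) e)

      iterate-% : ∀ {p x} .{{_ : NonZero p}} → iterate p x ≡ x → ∀ t → iterate t x ≡ iterate (t % p) x
      iterate-% {p} {x} e t = begin
        iterate t x                           ≡⟨ cong (λ w → iterate w x) (m≡m%n+[m/n]*n t p) ⟩
        iterate (t % p + t / p * p) x         ≡⟨ iterate-+ (t % p) _ x ⟩
        iterate (t % p) (iterate (t / p * p) x) ≡⟨ cong (iterate (t % p)) (iterate-* e (t / p)) ⟩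
        iterate (t % p) x                     ∎
        where open ≡-Reasoning

      ↝-bounded : ∀ {x z} → x ↝ z → ∃ λ t → t < N × iterate t x ≡ z
      ↝-bounded {x} (t , e) with period x
      ... | suc p , _ , p≤N , ep = t % suc p , <-≤-trans (m%n<n t (suc p)) p≤N , trans (sym (iterate-% ep t)) e

      returnsWithin-N : ∀ i → ReturnsWithin i N i
      returnsWithin-N i with period i
      ... | suc p , _ , p≤N , ep = p , p≤N , ep

      ↝-sym : ∀ {x z} → x ↝ z → z ↝ x
      ↝-sym {x} (t , refl) with period x
      ... | suc p , _ , _ , ep = t * p , (begin
        iterate (t * p) (iterate t x) ≡⟨ iterate-+ (t * p) t x ⟨
        iterate (t * p + t) x         ≡⟨ cong (λ w → iterate w x) (trans (+-comm (t * p) t) (sym (*-suc t p))) ⟩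
        iterate (t * suc p) x         ≡⟨ iterate-* ep t ⟩
        x                             ∎)
        where open ≡-Reasoning

      IsCycleMin : Fin N → Set
      IsCycleMin i = ∀ z → i ↝ z → toℕ i ≤ toℕ z

      isCycleMin⇒ : ∀ i → T (isCycleMin τ i) → IsCycleMin i
      isCycleMin⇒ i h z i↝z with ↝-bounded i↝z
      ... | t , t<N , refl = ≤ᵇ⇒≤ (toℕ i) _ (All.lookup (all⁺ _ (L.upTo N) h) (∈-upTo⁺ t<N))

      isCycleMin⇐ : ∀ i → IsCycleMin i → T (isCycleMin τ i)
      isCycleMin⇐ i min = all⁻ (λ j → toℕ i ≤ᵇ toℕ (iter τ j i)) {xs = L.upTo N} (All.tabulate (λ {t} _ → ≤⇒≤ᵇ (min _ (t , refl))))


module InsertionCycles where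

  open import Defs
  open FinEndomaps
  open Insertion
  open Orbits
  open import Data.Nat using (ℕ; zero; suc; _+_; _≤_; _<_)
  open import Data.Nat.Properties using (+-comm; +-identityʳ; <⇒≤; <⇒≱; ≤-reflexive)
  open import Data.Fin as F using (Fin; toℕ; inject₁; fromℕ)
  open import Data.Fin.Properties using (_≟_; toℕ-inject₁; toℕ-fromℕ; toℕ<n)
  open import Data.List as L using ([]; _∷_; _++_; map; filterᵇ; length)
  open import Data.List.Properties using (map-++; map-∘; map-tabulate; length-++; length-map; filter-++; filter-accept; filter-reject)
  open import Data.Bool using (Bool; true; false; T)
  open import Data.Product using (∃; _×_; _,_)
  open import Data.Sum using (_⊎_; inj₁; inj₂)
  open import Data.Empty using (⊥-elim)
  open import Relation.Nullary using (¬_; yes; no)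
  open import Relation.Nullary.Decidable using (T?)
  open import Relation.Binary.PropositionalEquality

  private
    variable A B : Set

    T-ext : ∀ {a b} → (T a → T b) → (T b → T a) → a ≡ b
    T-ext {true} {true} _ _ = refl
    T-ext {true} {false} a⇒b _ = ⊥-elim (a⇒b _)
    T-ext {false} {true} _ b⇒a = ⊥-elim (b⇒a _)
    T-ext {false} {false} _ _ = refl

    filterᵇ-map : (p : B → Bool) (q : A → Bool) (f : A → B) → (∀ x → p (f x) ≡ q x) →
      ∀ xs → filterᵇ p (map f xs) ≡ map f (filterᵇ q xs)
    filterᵇ-map p q f pf≗q [] = refl
    filterᵇ-map p q f pf≗q (x ∷ xs) rewrite pf≗q x with q x
    ... | true = cong (f x ∷_) (filterᵇ-map p q f pf≗q xs)
    ... | false = filterᵇ-map p q f pf≗q xs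

    allFin-suc : ∀ n → L.allFin (suc n) ≡ F.zero ∷ map F.suc (L.allFin n)
    allFin-suc n = cong (F.zero ∷_) (sym (map-tabulate (λ x → x) F.suc))

  allFin-∷ʳ : ∀ n → L.allFin (suc n) ≡ map inject₁ (L.allFin n) ++ (fromℕ n ∷ [])
  allFin-∷ʳ zero = refl
  allFin-∷ʳ (suc n) = begin
    L.allFin (suc (suc n))
      ≡⟨ allFin-suc (suc n) ⟩
    F.zero ∷ map F.suc (L.allFin (suc n))
      ≡⟨ cong (λ w → F.zero ∷ map F.suc w) (allFin-∷ʳ n) ⟩
    F.zero ∷ map F.suc (map inject₁ (L.allFin n) ++ (fromℕ n ∷ []))
      ≡⟨ cong (F.zero ∷_) (map-++ F.suc (map inject₁ (L.allFin n)) _) ⟩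
    F.zero ∷ (map F.suc (map inject₁ (L.allFin n)) ++ (fromℕ (suc n) ∷ []))
      ≡⟨ cong (λ w → F.zero ∷ (w ++ (fromℕ (suc n) ∷ []))) (trans (sym (map-∘ (L.allFin n))) (map-∘ (L.allFin n))) ⟩
    F.zero ∷ (map inject₁ (map F.suc (L.allFin n)) ++ (fromℕ (suc n) ∷ []))
      ≡⟨ cong (λ w → map inject₁ w ++ (fromℕ (suc n) ∷ [])) (allFin-suc n) ⟨
    map inject₁ (L.allFin (suc n)) ++ (fromℕ (suc n) ∷ []) ∎
    where open ≡-Reasoning

  module _ {n : ℕ} (σ : Fin n → Fin n) (σ-surj : Surj σ) where

    private
      τ-surj : ∀ j → Surj (insert σ j)
      τ-surj = Insert.insert-surj σ σ-surj
      open Insert σ using (insertAfter-self; insertAfter-other; insertAfter-new; insertFixed-old; insertFixed-new)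
      open Iterate σ using () renaming (_↝_ to _↝ˢ_; iterate to iterateˢ; ↝-refl to ↝ˢ-refl; ↝-step to ↝ˢ-step)
      open Iterate.Bijective σ σ-surj using () renaming (isCycleMin⇒ to isCycleMinˢ⇒; isCycleMin⇐ to isCycleMinˢ⇐)
      module Iterateᵗ j = Iterate (insert σ j)
      module Bijectiveᵗ j = Iterate.Bijective (insert σ j) (τ-surj j)

    iterate-insert-inject₁ : ∀ j i t →
        (∃ λ z → Iterateᵗ.iterate j t (inject₁ i) ≡ inject₁ z × i ↝ˢ z)
      ⊎ (Iterateᵗ.iterate j t (inject₁ i) ≡ fromℕ n × ∃ λ x → j ≡ inject₁ x × i ↝ˢ x)
    iterate-insert-inject₁ j i zero = inj₁ (i , refl , ↝ˢ-refl)
    iterate-insert-inject₁ j i (suc t) with iterate-insert-inject₁ j i t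
    ... | inj₂ (e , x , refl , i↝x) = inj₁ (σ x , trans (cong (insert σ j) e) (insertAfter-new x) , ↝ˢ-step i↝x)
    ... | inj₁ (z , e , i↝z) with inject₁-or-fromℕ j
    ...   | inj₂ refl = inj₁ (σ z , trans (cong (insert σ j) e) (insertFixed-old z) , ↝ˢ-step i↝z)
    ...   | inj₁ (x , refl) with z ≟ x
    ...     | yes refl = inj₂ (trans (cong (insert σ j) e) (insertAfter-self z) , z , refl , i↝z)
    ...     | no z≢x = inj₁ (σ z , trans (cong (insert σ j) e) (insertAfter-other x z z≢x) , ↝ˢ-step i↝z)

    ↝-insert-inject₁ : ∀ j {i z} → i ↝ˢ z → Iterateᵗ._↝_ j (inject₁ i) (inject₁ z)
    ↝-insert-inject₁ j {i} (t , refl) = reach t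
      where
      open Iterateᵗ j using (_↝_; ↝-refl; ↝-step)
      reach : ∀ t → inject₁ i ↝ inject₁ (iterateˢ t i)
      reach zero = ↝-refl
      reach (suc t) with inject₁-or-fromℕ j
      ... | inj₂ refl = subst (inject₁ i ↝_) (insertFixed-old _) (↝-step (reach t))
      ... | inj₁ (x , refl) with iterateˢ t i ≟ x
      ...   | no y≢x = subst (inject₁ i ↝_) (insertAfter-other x _ y≢x) (↝-step (reach t))
      ...   | yes refl = subst (inject₁ i ↝_) (trans (cong (insert σ (inject₁ x)) (insertAfter-self x)) (insertAfter-new x))
                                 (↝-step (↝-step (reach t)))

    isCycleMin-insert-inject₁ : ∀ j i → isCycleMin (insert σ j) (inject₁ i) ≡ isCycleMin σ i
    isCycleMin-insert-inject₁ j i = T-ext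
      (λ min → isCycleMinˢ⇐ i (λ z i↝z → subst₂ _≤_ (toℕ-inject₁ i) (toℕ-inject₁ z)
                                           (Bijectiveᵗ.isCycleMin⇒ j _ min _ (↝-insert-inject₁ j i↝z))))
      (λ min → Bijectiveᵗ.isCycleMin⇐ j _ (λ w (t , e) → below min w t e))
      where
      below : T (isCycleMin σ i) → ∀ w t → Iterateᵗ.iterate j t (inject₁ i) ≡ w → toℕ (inject₁ i) ≤ toℕ w
      below min w t refl with iterate-insert-inject₁ j i t
      ... | inj₁ (z , e , i↝z) rewrite e = subst₂ _≤_ (sym (toℕ-inject₁ i)) (sym (toℕ-inject₁ z)) (isCycleMinˢ⇒ i min z i↝z)
      ... | inj₂ (e , _) rewrite e = subst₂ _≤_ (sym (toℕ-inject₁ i)) (sym (toℕ-fromℕ n)) (<⇒≤ (toℕ<n i))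

    isCycleMin-insertFixed-new : T (isCycleMin (insert σ (fromℕ n)) (fromℕ n))
    isCycleMin-insertFixed-new = Bijectiveᵗ.isCycleMin⇐ (fromℕ n) (fromℕ n) (λ z (t , e) → ≤-reflexive (cong toℕ (trans (sym (fixed t)) e)))
      where
      fixed : ∀ t → Iterateᵗ.iterate (fromℕ n) t (fromℕ n) ≡ fromℕ n
      fixed zero = refl
      fixed (suc t) = trans (cong (insert σ (fromℕ n)) (fixed t)) insertFixed-new

    isCycleMin-insertAfter-new : ∀ x → ¬ T (isCycleMin (insert σ (inject₁ x)) (fromℕ n))
    isCycleMin-insertAfter-new x min = <⇒≱ σx<n (Bijectiveᵗ.isCycleMin⇒ (inject₁ x) (fromℕ n) min _ (1 , insertAfter-new x))
      where
      σx<n : toℕ (inject₁ (σ x)) < toℕ (fromℕ n)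
      σx<n = subst₂ _<_ (sym (toℕ-inject₁ (σ x))) (sym (toℕ-fromℕ n)) (toℕ<n (σ x))

    cycleMins-insert : ∀ j → cycleMins (insert σ j) ≡ map inject₁ (cycleMins σ) ++ filterᵇ (isCycleMin (insert σ j)) (fromℕ n ∷ [])
    cycleMins-insert j = begin
      filterᵇ (isCycleMin (insert σ j)) (L.allFin (suc n))
        ≡⟨ cong (filterᵇ _) (allFin-∷ʳ n) ⟩
      filterᵇ (isCycleMin (insert σ j)) (map inject₁ (L.allFin n) ++ (fromℕ n ∷ []))
        ≡⟨ filter-++ (λ i → T? (isCycleMin (insert σ j) i)) (map inject₁ (L.allFin n)) _ ⟩
      filterᵇ (isCycleMin (insert σ j)) (map inject₁ (L.allFin n)) ++ filterᵇ (isCycleMin (insert σ j)) (fromℕ n ∷ [])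
        ≡⟨ cong (_++ filterᵇ (isCycleMin (insert σ j)) (fromℕ n ∷ []))
                (filterᵇ-map _ (isCycleMin σ) inject₁ (isCycleMin-insert-inject₁ j) (L.allFin n)) ⟩
      map inject₁ (cycleMins σ) ++ filterᵇ (isCycleMin (insert σ j)) (fromℕ n ∷ []) ∎
      where open ≡-Reasoning

    cycleMins-insertFixed : cycleMins (insert σ (fromℕ n)) ≡ map inject₁ (cycleMins σ) ++ (fromℕ n ∷ [])
    cycleMins-insertFixed = trans (cycleMins-insert (fromℕ n))
      (cong (map inject₁ (cycleMins σ) ++_) (filter-accept (λ i → T? (isCycleMin (insert σ (fromℕ n)) i)) {xs = []} isCycleMin-insertFixed-new))

    numCycles-insertFixed : numCycles (insert σ (fromℕ n)) ≡ suc (numCycles σ)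
    numCycles-insertFixed = begin
      length (cycleMins (insert σ (fromℕ n)))              ≡⟨ cong length cycleMins-insertFixed ⟩
      length (map inject₁ (cycleMins σ) ++ (fromℕ n ∷ [])) ≡⟨ length-++ (map inject₁ (cycleMins σ)) ⟩
      length (map inject₁ (cycleMins σ)) + 1               ≡⟨ cong (_+ 1) (length-map inject₁ (cycleMins σ)) ⟩
      numCycles σ + 1                                      ≡⟨ +-comm _ 1 ⟩
      suc (numCycles σ)                                    ∎
      where open ≡-Reasoning

    cycleMins-insertAfter : ∀ x → cycleMins (insert σ (inject₁ x)) ≡ map inject₁ (cycleMins σ) ++ []
    cycleMins-insertAfter x = trans (cycleMins-insert (inject₁ x))
      (cong (map inject₁ (cycleMins σ) ++_)
            (filter-reject (λ i → T? (isCycleMin (insert σ (inject₁ x)) i)) {x = fromℕ n} {xs = []} (isCycleMin-insertAfter-new x)))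

    numCycles-insertAfter : ∀ x → numCycles (insert σ (inject₁ x)) ≡ numCycles σ
    numCycles-insertAfter x = begin
      length (cycleMins (insert σ (inject₁ x)))     ≡⟨ cong length (cycleMins-insertAfter x) ⟩
      length (map inject₁ (cycleMins σ) ++ [])      ≡⟨ length-++ (map inject₁ (cycleMins σ)) ⟩
      length (map inject₁ (cycleMins σ)) + 0        ≡⟨ +-identityʳ _ ⟩
      length (map inject₁ (cycleMins σ))            ≡⟨ length-map inject₁ (cycleMins σ) ⟩
      numCycles σ                                   ∎
      where open ≡-Reasoning


module FlattenInsertion where

  open import Defs
  open FinEndomaps
  open Insertion
  open Orbits
  open InsertionCycles
  open import Data.Nat as ℕ using (ℕ; suc; _+_)
  open import Data.Nat.Properties using (+-suc; +-comm; +-identityʳ)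
  open import Data.Fin using (Fin; toℕ; inject₁; fromℕ)
  open import Data.Fin.Properties using (_≟_; toℕ-inject₁; toℕ-fromℕ; toℕ-injective; inject₁-injective)
  open import Data.List as L using (List; []; _∷_; _++_; map; concatMap)
  open import Data.List.Properties using (map-++; map-∘; map-cong; concatMap-++; concatMap-map; concatMap-cong; map-concatMap; ++-identityʳ)
  open import Data.Bool using (if_then_else_)
  open import Function.Base using (_∘_)
  open import Relation.Nullary using (yes; no)
  open import Relation.Nullary.Decidable using (⌊_⌋)
  open import Relation.Nullary.Negation using (contradiction)
  open import Relation.Binary.PropositionalEquality

  insertAfterℕ : ℕ → ℕ → List ℕ → List ℕ
  insertAfterℕ v m = concatMap (λ w → if ⌊ w ℕ.≟ v ⌋ then w ∷ m ∷ [] else w ∷ [])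

  private
    concatMap-concatMap : ∀ {A B C : Set} (h : B → List C) (g : A → List B) (xs : List A) →
      concatMap h (concatMap g xs) ≡ concatMap (concatMap h ∘ g) xs
    concatMap-concatMap h g [] = refl
    concatMap-concatMap h g (x ∷ xs) =
      trans (concatMap-++ h (g x) (concatMap g xs)) (cong (concatMap h (g x) ++_) (concatMap-concatMap h g xs))

  module _ {n : ℕ} (σ : Fin n → Fin n) (σ-surj : Surj σ) where

    private
      open Insert σ using (insertAfter-self; insertAfter-other; insertAfter-new; insertFixed-old; insertFixed-new)
      open Iterate σ using (ReturnsWithin; returnsWithin-step)
      open Iterate.Bijective σ σ-surj using (returnsWithin-N)

      cycle : Fin n → List (Fin n)
      cycle c = orbitFrom σ c n c

      insertAfterᶠ : Fin n → List (Fin n) → List (Fin (suc n))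
      insertAfterᶠ x = concatMap (λ z → if ⌊ z ≟ x ⌋ then inject₁ z ∷ fromℕ n ∷ [] else inject₁ z ∷ [])

      map-toℕ-insertAfterᶠ : ∀ x zs → map toℕ (insertAfterᶠ x zs) ≡ insertAfterℕ (toℕ x) n (map toℕ zs)
      map-toℕ-insertAfterᶠ x [] = refl
      map-toℕ-insertAfterᶠ x (z ∷ zs) with z ≟ x | toℕ z ℕ.≟ toℕ x
      ... | yes _ | yes _ = cong₂ _∷_ (toℕ-inject₁ z) (cong₂ _∷_ (toℕ-fromℕ n) (map-toℕ-insertAfterᶠ x zs))
      ... | yes z≡x | no z≢x = contradiction (cong toℕ z≡x) z≢x
      ... | no z≢x | yes z≡x = contradiction (toℕ-injective z≡x) z≢x
      ... | no _ | no _ = cong₂ _∷_ (toℕ-inject₁ z) (map-toℕ-insertAfterᶠ x zs)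

      map-toℕ-inject₁ : (zs : List (Fin n)) → map toℕ (map inject₁ zs) ≡ map toℕ zs
      map-toℕ-inject₁ zs = trans (sym (map-∘ zs)) (map-cong toℕ-inject₁ zs)

    module _ where
      private
        τ = insert σ (fromℕ n)
        cycleᵗ : Fin (suc n) → List (Fin (suc n))
        cycleᵗ c = orbitFrom τ c (suc n) c
        open Iterate τ using () renaming (orbitFrom-stop to stopᵗ; orbitFrom-step to stepᵗ)

      orbitFrom-insertFixed : ∀ f e i y → ReturnsWithin i f y →
        orbitFrom τ (inject₁ i) (f + e) (inject₁ y) ≡ map inject₁ (orbitFrom σ i f y)
      orbitFrom-insertFixed (suc f) e i y r with σ y ≟ i
      ... | yes σy≡i = stopᵗ (trans (insertFixed-old y) (cong inject₁ σy≡i))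
      ... | no σy≢i = begin
        orbitFrom τ (inject₁ i) (suc f + e) (inject₁ y)
          ≡⟨ stepᵗ (σy≢i ∘ inject₁-injective ∘ trans (sym (insertFixed-old y))) ⟩
        inject₁ y ∷ orbitFrom τ (inject₁ i) (f + e) (τ (inject₁ y))
          ≡⟨ cong (λ w → inject₁ y ∷ orbitFrom τ (inject₁ i) (f + e) w) (insertFixed-old y) ⟩
        inject₁ y ∷ orbitFrom τ (inject₁ i) (f + e) (inject₁ (σ y))
          ≡⟨ cong (inject₁ y ∷_) (orbitFrom-insertFixed f e i (σ y) (returnsWithin-step r σy≢i)) ⟩
        inject₁ y ∷ map inject₁ (orbitFrom σ i f (σ y)) ∎
        where open ≡-Reasoning

      flatten-insertFixed : flatten τ ≡ flatten σ ++ (n ∷ [])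
      flatten-insertFixed = begin
        map toℕ (concatMap cycleᵗ (cycleMins τ))
          ≡⟨ cong (map toℕ ∘ concatMap cycleᵗ) (cycleMins-insertFixed σ σ-surj) ⟩
        map toℕ (concatMap cycleᵗ (map inject₁ (cycleMins σ) ++ (fromℕ n ∷ [])))
          ≡⟨ cong (map toℕ) (concatMap-++ cycleᵗ (map inject₁ (cycleMins σ)) _) ⟩
        map toℕ (concatMap cycleᵗ (map inject₁ (cycleMins σ)) ++ (cycleᵗ (fromℕ n) ++ []))
          ≡⟨ cong₂ (λ u v → map toℕ (u ++ (v ++ []))) (concatMap-map cycleᵗ inject₁ (cycleMins σ)) (stopᵗ insertFixed-new) ⟩
        map toℕ (concatMap (cycleᵗ ∘ inject₁) (cycleMins σ) ++ (fromℕ n ∷ []))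
          ≡⟨ cong (λ u → map toℕ (u ++ (fromℕ n ∷ []))) (concatMap-cong cycle-insertFixed (cycleMins σ)) ⟩
        map toℕ (concatMap (map inject₁ ∘ cycle) (cycleMins σ) ++ (fromℕ n ∷ []))
          ≡⟨ map-++ toℕ (concatMap (map inject₁ ∘ cycle) (cycleMins σ)) _ ⟩
        map toℕ (concatMap (map inject₁ ∘ cycle) (cycleMins σ)) ++ (toℕ (fromℕ n) ∷ [])
          ≡⟨ cong₂ (λ u v → map toℕ u ++ (v ∷ [])) (map-concatMap inject₁ cycle (cycleMins σ)) (sym (toℕ-fromℕ n)) ⟨
        map toℕ (map inject₁ (concatMap cycle (cycleMins σ))) ++ (n ∷ [])
          ≡⟨ cong (_++ (n ∷ [])) (map-toℕ-inject₁ (concatMap cycle (cycleMins σ))) ⟩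
        flatten σ ++ (n ∷ []) ∎
        where
        open ≡-Reasoning
        cycle-insertFixed : ∀ c → cycleᵗ (inject₁ c) ≡ map inject₁ (cycle c)
        cycle-insertFixed c = trans (cong (λ F → orbitFrom τ (inject₁ c) F (inject₁ c)) (+-comm 1 n))
                                    (orbitFrom-insertFixed n 1 c c (returnsWithin-N c))

    module _ (x : Fin n) where
      private
        τ = insert σ (inject₁ x)
        cycleᵗ : Fin (suc n) → List (Fin (suc n))
        cycleᵗ c = orbitFrom τ c (suc n) c
        open Iterate τ using () renaming (orbitFrom-stop to stopᵗ; orbitFrom-step to stepᵗ; orbitFrom-extraFuel to extraFuelᵗ)
        open Iterate.Bijective τ (Insert.insert-surj σ σ-surj (inject₁ x)) using () renaming (returnsWithin-N to returnsWithinᵗ-N)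

      -- The walk in τ is one step longer than in σ; the fuel f + suc f leaves room for that step.
      orbitFrom-insertAfter : ∀ f e i y → ReturnsWithin i f y →
        orbitFrom τ (inject₁ i) (f + suc f + e) (inject₁ y) ≡ insertAfterᶠ x (orbitFrom σ i f y)
      orbitFrom-insertAfter (suc f) e i y r with y ≟ x | σ y ≟ i
      ... | no y≢x | yes σy≡i = stopᵗ (trans (insertAfter-other x y y≢x) (cong inject₁ σy≡i))
      ... | no y≢x | no σy≢i = begin
        orbitFrom τ (inject₁ i) (suc f + suc (suc f) + e) (inject₁ y)
          ≡⟨ stepᵗ (σy≢i ∘ inject₁-injective ∘ trans (sym (insertAfter-other x y y≢x))) ⟩
        inject₁ y ∷ orbitFrom τ (inject₁ i) (f + suc (suc f) + e) (τ (inject₁ y))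
          ≡⟨ cong₂ (λ F w → inject₁ y ∷ orbitFrom τ (inject₁ i) F w)
                   (trans (cong (_+ e) (+-suc f (suc f))) (sym (+-suc (f + suc f) e))) (insertAfter-other x y y≢x) ⟩
        inject₁ y ∷ orbitFrom τ (inject₁ i) (f + suc f + suc e) (inject₁ (σ y))
          ≡⟨ cong (inject₁ y ∷_) (orbitFrom-insertAfter f (suc e) i (σ y) (returnsWithin-step r σy≢i)) ⟩
        inject₁ y ∷ insertAfterᶠ x (orbitFrom σ i f (σ y)) ∎
        where open ≡-Reasoning
      ... | yes refl | yes σx≡i = begin
        orbitFrom τ (inject₁ i) (suc f + suc (suc f) + e) (inject₁ x)
          ≡⟨ stepᵗ (λ e → inject₁≢fromℕ i (trans (sym e) (insertAfter-self x))) ⟩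
        inject₁ x ∷ orbitFrom τ (inject₁ i) (f + suc (suc f) + e) (τ (inject₁ x))
          ≡⟨ cong₂ (λ F w → inject₁ x ∷ orbitFrom τ (inject₁ i) F w) (cong (_+ e) (+-suc f (suc f))) (insertAfter-self x) ⟩
        inject₁ x ∷ orbitFrom τ (inject₁ i) (suc (f + suc f + e)) (fromℕ n)
          ≡⟨ cong (inject₁ x ∷_) (stopᵗ (trans (insertAfter-new x) (cong inject₁ σx≡i))) ⟩
        inject₁ x ∷ fromℕ n ∷ [] ∎
        where open ≡-Reasoning
      ... | yes refl | no σx≢i = begin
        orbitFrom τ (inject₁ i) (suc f + suc (suc f) + e) (inject₁ x)
          ≡⟨ stepᵗ (λ e → inject₁≢fromℕ i (trans (sym e) (insertAfter-self x))) ⟩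
        inject₁ x ∷ orbitFrom τ (inject₁ i) (f + suc (suc f) + e) (τ (inject₁ x))
          ≡⟨ cong₂ (λ F w → inject₁ x ∷ orbitFrom τ (inject₁ i) F w) (cong (_+ e) (+-suc f (suc f))) (insertAfter-self x) ⟩
        inject₁ x ∷ orbitFrom τ (inject₁ i) (suc (f + suc f + e)) (fromℕ n)
          ≡⟨ cong (inject₁ x ∷_) (stepᵗ (σx≢i ∘ inject₁-injective ∘ trans (sym (insertAfter-new x)))) ⟩
        inject₁ x ∷ fromℕ n ∷ orbitFrom τ (inject₁ i) (f + suc f + e) (τ (fromℕ n))
          ≡⟨ cong (λ w → inject₁ x ∷ fromℕ n ∷ orbitFrom τ (inject₁ i) (f + suc f + e) w) (insertAfter-new x) ⟩
        inject₁ x ∷ fromℕ n ∷ orbitFrom τ (inject₁ i) (f + suc f + e) (inject₁ (σ x))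
          ≡⟨ cong (λ w → inject₁ x ∷ fromℕ n ∷ w) (orbitFrom-insertAfter f e i (σ x) (returnsWithin-step r σx≢i)) ⟩
        inject₁ x ∷ fromℕ n ∷ insertAfterᶠ x (orbitFrom σ i f (σ x)) ∎
        where open ≡-Reasoning

      flatten-insertAfter : flatten τ ≡ insertAfterℕ (toℕ x) n (flatten σ)
      flatten-insertAfter = begin
        map toℕ (concatMap cycleᵗ (cycleMins τ))
          ≡⟨ cong (map toℕ ∘ concatMap cycleᵗ) (trans (cycleMins-insertAfter σ σ-surj x) (++-identityʳ _)) ⟩
        map toℕ (concatMap cycleᵗ (map inject₁ (cycleMins σ)))
          ≡⟨ cong (map toℕ) (concatMap-map cycleᵗ inject₁ (cycleMins σ)) ⟩
        map toℕ (concatMap (cycleᵗ ∘ inject₁) (cycleMins σ))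
          ≡⟨ cong (map toℕ) (concatMap-cong cycle-insertAfter (cycleMins σ)) ⟩
        map toℕ (concatMap (insertAfterᶠ x ∘ cycle) (cycleMins σ))
          ≡⟨ cong (map toℕ) (concatMap-concatMap _ cycle (cycleMins σ)) ⟨
        map toℕ (insertAfterᶠ x (concatMap cycle (cycleMins σ)))
          ≡⟨ map-toℕ-insertAfterᶠ x (concatMap cycle (cycleMins σ)) ⟩
        insertAfterℕ (toℕ x) n (flatten σ) ∎
        where
        open ≡-Reasoning
        cycle-insertAfter : ∀ c → cycleᵗ (inject₁ c) ≡ insertAfterᶠ x (cycle c)
        cycle-insertAfter c = begin
          orbitFrom τ (inject₁ c) (suc n) (inject₁ c)
            ≡⟨ extraFuelᵗ (inject₁ c) (suc n) (inject₁ c) n (returnsWithinᵗ-N (inject₁ c)) ⟨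
          orbitFrom τ (inject₁ c) (suc n + n) (inject₁ c)
            ≡⟨ cong (λ F → orbitFrom τ (inject₁ c) F (inject₁ c)) (trans (+-comm (suc n) n) (sym (+-identityʳ _))) ⟩
          orbitFrom τ (inject₁ c) (n + suc n + 0) (inject₁ c)
            ≡⟨ orbitFrom-insertAfter n 0 c c (returnsWithin-N c) ⟩
          insertAfterᶠ x (cycle c) ∎


module FlattenPermutation where

  open import Defs
  open FinEndomaps
  open Orbits
  open import Data.Nat using (ℕ; zero; suc; _+_; _∸_; _≤_; _<_; _≤ᵇ_; z≤n; s≤s; _≟_)
  open import Data.Nat.Properties
    using (+-suc; +-comm; +-identityʳ; ≤-refl; ≤-pred; <⇒≤; <⇒≱; ≤-<-trans; m<m+n; m<n⇒m<1+n; ≤∧≢⇒<;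
           m<n⇒0<n∸m; m∸n≤m; m+[n∸m]≡n; ≤-antisym)
  open import Data.Nat.DivMod using (_%_; m%n<n)
  open import Data.Fin using (Fin; toℕ; fromℕ<)
  import Data.Fin as Fin
  open import Data.Fin.Properties using (toℕ-injective; toℕ<n; toℕ-fromℕ<)
  open import Data.List as L using (List; []; _∷_; map; concatMap)
  open import Data.List.Extrema.Nat using (argmin; argmin-sel; f[argmin]≤f[xs])
  open import Data.List.Membership.Propositional using (_∈_; find)
  open import Data.List.Membership.Propositional.Properties
    using (∈-concatMap⁺; ∈-concatMap⁻; ∈-map⁺; ∈-map⁻; ∈-allFin; ∈-upTo⁺; ∈-upTo⁻; ∈-filter⁺; ∈-filter⁻)
  open import Data.List.Membership.Propositional.Properties.WithK using (unique∧set⇒bag)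
  open import Data.List.Relation.Unary.Any as Any using (here; there)
  open import Data.List.Relation.Unary.All as All using ()
  open import Data.List.Relation.Unary.All.Properties using (all⁻)
  open import Data.List.Relation.Unary.Unique.Propositional using (Unique)
  import Data.List.Relation.Unary.Unique.Propositional.Properties as Unique
  open import Data.List.Relation.Binary.Permutation.Propositional using (_↭_)
  open import Data.List.Relation.Binary.BagAndSetEquality using (∼bag⇒↭)
  open import Data.Bool using (true; T)
  open import Data.Product using (∃; _×_; _,_; proj₂)
  import Data.Sum as Sum
  open Sum using (_⊎_; inj₁; inj₂)
  open import Function.Bundles using (mk⇔)
  open import Relation.Nullary using (yes; no)
  open import Relation.Nullary.Decidable using (T?)
  open import Relation.Nullary.Negation using (contradiction)
  open import Relation.Binary.PropositionalEquality

  unique-concatMap : ∀ {A B : Set} (f : A → List B) (xs : List A) → Unique xs → (∀ x → x ∈ xs → Unique (f x)) →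
    (∀ {x y z} → x ∈ xs → y ∈ xs → z ∈ f x → z ∈ f y → x ≡ y) → Unique (concatMap f xs)
  unique-concatMap f [] _ _ _ = Unique.[]
  unique-concatMap f (x ∷ xs) (x∉xs Unique.∷ xs!) f! disjoint =
    Unique.++⁺ (f! x (here refl)) (unique-concatMap f xs xs! (λ y m → f! y (there m)) (λ mx my → disjoint (there mx) (there my)))
      (λ (z∈fx , z∈rest) → let y , y∈xs , z∈fy = find (∈-concatMap⁻ f z∈rest)
                           in All.lookup x∉xs y∈xs (disjoint (here refl) (there y∈xs) z∈fx z∈fy))

  module _ {n : ℕ} (σ : Fin n → Fin n) (σ-surj : Surj σ) where

    private
      open Iterate σ
      open Bijective σ-surj

      cycle : Fin n → List (Fin n)
      cycle c = orbitFrom σ c n c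

    module _ (c : Fin n) where

      orbitSegment : ℕ → ℕ → List (Fin n)
      orbitSegment a zero = []
      orbitSegment a (suc L) = iterate a c ∷ orbitSegment (suc a) L

      ∈-orbitSegment⁻ : ∀ a L {z} → z ∈ orbitSegment a L → ∃ λ t → a ≤ t × t < a + L × iterate t c ≡ z
      ∈-orbitSegment⁻ a (suc L) (here refl) = a , ≤-refl , m<m+n a (s≤s z≤n) , refl
      ∈-orbitSegment⁻ a (suc L) (there m) with ∈-orbitSegment⁻ (suc a) L m
      ... | t , a<t , t<aL , e = t , <⇒≤ a<t , subst (t <_) (sym (+-suc a L)) t<aL , e

      ∈-orbitSegment⁺ : ∀ a L t → a ≤ t → t < a + L → iterate t c ∈ orbitSegment a L
      ∈-orbitSegment⁺ a zero t a≤t t<a = contradiction (subst (_≤ t) (sym (+-identityʳ a)) a≤t) (<⇒≱ t<a)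
      ∈-orbitSegment⁺ a (suc L) t a≤t t<aL with a ≟ t
      ... | yes refl = here refl
      ... | no a≢t = there (∈-orbitSegment⁺ (suc a) L t (≤∧≢⇒< a≤t a≢t) (subst (t <_) (+-suc a L) t<aL))

      NoReturnBefore : ℕ → Set
      NoReturnBefore B = ∀ t → 0 < t → t < B → iterate t c ≢ c

      orbitSegment-unique : ∀ a L → NoReturnBefore (a + L) → Unique (orbitSegment a L)
      orbitSegment-unique a zero _ = Unique.[]
      orbitSegment-unique a (suc L) noReturn =
        All.tabulate distinct Unique.∷ orbitSegment-unique (suc a) L (subst NoReturnBefore (+-suc a L) noReturn)
        where
        distinct : ∀ {z} → z ∈ orbitSegment (suc a) L → iterate a c ≢ z
        distinct m e with ∈-orbitSegment⁻ (suc a) L m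
        ... | t , a<t , t<aL , e′ = noReturn (t ∸ a) (m<n⇒0<n∸m a<t) (≤-<-trans (m∸n≤m t a) (subst (t <_) (sym (+-suc a L)) t<aL))
          (iterate-injective a (begin
            iterate a (iterate (t ∸ a) c) ≡⟨ iterate-+ a (t ∸ a) c ⟨
            iterate (a + (t ∸ a)) c       ≡⟨ cong (λ w → iterate w c) (m+[n∸m]≡n (<⇒≤ a<t)) ⟩
            iterate t c                   ≡⟨ trans e′ (sym e) ⟩
            iterate a c                   ∎))
          where open ≡-Reasoning

      orbitFrom-segment : ∀ f a → NoReturnBefore (suc a) →
        ∃ λ L → orbitFrom σ c f (iterate a c) ≡ orbitSegment a L × NoReturnBefore (a + L) × (L ≡ f ⊎ iterate (a + L) c ≡ c)
      orbitFrom-segment zero a noReturn =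
        0 , refl , (λ t p q → noReturn t p (m<n⇒m<1+n (subst (t <_) (+-identityʳ a) q))) , inj₁ refl
      orbitFrom-segment (suc f) a noReturn with σ (iterate a c) Fin.≟ c
      ... | yes back = 1 , refl , subst NoReturnBefore (+-comm 1 a) noReturn ,
                       inj₂ (trans (cong (λ w → iterate w c) (+-comm a 1)) back)
      ... | no ¬back with orbitFrom-segment f (suc a) noReturn′
        where
        noReturn′ : NoReturnBefore (suc (suc a))
        noReturn′ t p q with t ≟ suc a
        ... | yes refl = ¬back
        ... | no t≢ = noReturn t p (≤∧≢⇒< (≤-pred q) t≢)
      ... | L , e , noReturn″ , done =
        suc L , cong (iterate a c ∷_) e , subst NoReturnBefore (sym (+-suc a L)) noReturn″ ,
        Sum.map (cong suc) (trans (cong (λ w → iterate w c) (+-suc a L))) done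

    cycle≢[] : ∀ c → cycle c ≢ []
    cycle≢[] c = nonempty (≤-<-trans z≤n (toℕ<n c))
      where
      nonempty : ∀ {f} → 0 < f → orbitFrom σ c f c ≢ []
      nonempty {suc f} _ ()

    cycle-segment : ∀ c → ∃ λ L → cycle c ≡ orbitSegment c 0 L × NoReturnBefore c L × iterate L c ≡ c × 0 < L
    cycle-segment c with orbitFrom-segment c n 0 (λ { t p (s≤s q) → contradiction q (<⇒≱ p) })
    ... | suc L , e , noReturn , inj₂ back = suc L , e , noReturn , back , s≤s z≤n
    ... | zero , e , _ , inj₂ _ = contradiction e (cycle≢[] c)
    ... | L , e , noReturn , inj₁ refl with period c
    ... | p , 1≤p , p≤n , back with p ≟ n
    ...   | yes refl = n , e , noReturn , back , 1≤p
    ...   | no p≢n = contradiction back (noReturn p 1≤p (≤∧≢⇒< p≤n p≢n))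

    ∈-cycle⁻ : ∀ {c z} → z ∈ cycle c → c ↝ z
    ∈-cycle⁻ {c} m with cycle-segment c
    ... | L , e , _ = let t , _ , _ , e′ = ∈-orbitSegment⁻ c 0 L (subst (_ ∈_) e m) in t , e′

    ∈-cycle⁺ : ∀ {c z} → c ↝ z → z ∈ cycle c
    ∈-cycle⁺ {c} (t , refl) with cycle-segment c
    ... | suc L , e , _ , back , _ = subst (iterate t c ∈_) (sym e)
      (subst (_∈ orbitSegment c 0 (suc L)) (sym (iterate-% back t)) (∈-orbitSegment⁺ c 0 (suc L) (t % suc L) z≤n (m%n<n t (suc L))))

    cycle-unique : ∀ c → Unique (cycle c)
    cycle-unique c with cycle-segment c
    ... | L , e , noReturn , _ = subst Unique (sym e) (orbitSegment-unique c 0 L noReturn)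

    ∈cycleMins⇒IsCycleMin : ∀ {c} → c ∈ cycleMins σ → IsCycleMin c
    ∈cycleMins⇒IsCycleMin {c} m = isCycleMin⇒ c (proj₂ (∈-filter⁻ (λ i → T? (isCycleMin σ i)) {xs = L.allFin n} m))

    cycles-disjoint : ∀ {c c′ z} → c ∈ cycleMins σ → c′ ∈ cycleMins σ → z ∈ cycle c → z ∈ cycle c′ → c ≡ c′
    cycles-disjoint {c} {c′} m m′ z∈c z∈c′ = toℕ-injective (≤-antisym
      (∈cycleMins⇒IsCycleMin m c′ (↝-trans (∈-cycle⁻ z∈c) (↝-sym (∈-cycle⁻ z∈c′))))
      (∈cycleMins⇒IsCycleMin m′ c (↝-trans (∈-cycle⁻ z∈c′) (↝-sym (∈-cycle⁻ z∈c)))))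

    -- The witness is the least element of the cycle of z.
    ∈-some-cycle : ∀ z → ∃ λ c → c ∈ cycleMins σ × z ∈ cycle c
    ∈-some-cycle z = m , ∈-filter⁺ (λ i → T? (isCycleMin σ i)) (∈-allFin m) (isCycleMin⇐ m m-min) , ∈-cycle⁺ (↝-sym z↝m)
      where
      m = argmin toℕ z (cycle z)
      z↝m : z ↝ m
      z↝m with argmin-sel toℕ z (cycle z)
      ... | inj₁ m≡z = 0 , sym m≡z
      ... | inj₂ m∈ = ∈-cycle⁻ m∈
      m-min : IsCycleMin m
      m-min w m↝w = All.lookup (f[argmin]≤f[xs] z (cycle z)) (∈-cycle⁺ (↝-trans z↝m m↝w))

    flatten-unique : Unique (flatten σ)
    flatten-unique = Unique.map⁺ toℕ-injective
      (unique-concatMap cycle (cycleMins σ) (Unique.filter⁺ _ (Unique.allFin⁺ n)) (λ c _ → cycle-unique c) cycles-disjoint)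

    flatten-↭-upTo : flatten σ ↭ L.upTo n
    flatten-↭-upTo = ∼bag⇒↭ (unique∧set⇒bag flatten-unique (Unique.upTo⁺ n) (mk⇔ to from))
      where
      to : ∀ {y} → y ∈ flatten σ → y ∈ L.upTo n
      to m with ∈-map⁻ toℕ m
      ... | z , _ , refl = ∈-upTo⁺ (toℕ<n z)
      from : ∀ {y} → y ∈ L.upTo n → y ∈ flatten σ
      from m with ∈-some-cycle (fromℕ< (∈-upTo⁻ m))
      ... | c , c∈ , z∈c = subst (_∈ flatten σ) (toℕ-fromℕ< (∈-upTo⁻ m))
                                 (∈-map⁺ toℕ (∈-concatMap⁺ cycle (Any.map (λ {refl → z∈c}) c∈)))

  flatten-starts-0 : ∀ {n} (σ : Fin (suc n) → Fin (suc n)) → ∃ λ ws → flatten σ ≡ 0 ∷ ws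
  flatten-starts-0 {n} σ with isCycleMin σ Fin.zero | zero-isCycleMin
    where
    zero-isCycleMin : T (isCycleMin σ Fin.zero)
    zero-isCycleMin = all⁻ (λ j → 0 ≤ᵇ toℕ (iter σ j Fin.zero)) {xs = L.upTo (suc n)} (All.tabulate (λ _ → _))
  ... | true | _ = _ , refl


module DescentGain where

  open import Defs
  open Counting
  open FlattenInsertion using (insertAfterℕ)
  open import Data.Nat using (ℕ; zero; suc; _+_; _∸_; _≤_; _<_; _≤ᵇ_)
  import Data.Nat as ℕ
  open import Data.Nat.Properties
    using (+-comm; +-assoc; +-suc; +-cancelʳ-≡; 1+n≢n; +-identityʳ; suc-injective; ≤-refl; ≤-trans; ≤-pred; <⇒≤; <⇒≱; <-≤-trans;
           m≤m+n; m∸n+n≡m; m+[n∸m]≡n; +-monoˡ-≤; +-monoˡ-<; ≤ᵇ⇒≤; ≤⇒≤ᵇ)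
  open import Data.Nat.Tactic.RingSolver using (solve-∀)
  open import Data.List as L using (List; []; _∷_; _++_; map; length; drop)
  open import Data.List.Properties using (map-cong; map-cong-local; map-∘; upTo-∷ʳ; length-upTo)
  open import Data.List.Membership.Propositional using (_∉_)
  open import Data.List.Membership.Propositional.Properties using (∈-upTo⁻)
  open import Data.List.Relation.Unary.Any using (here; there)
  open import Data.List.Relation.Unary.All as All using (All; []; _∷_)
  open import Data.List.Relation.Unary.Unique.Propositional using (Unique)
  open import Data.List.Relation.Binary.Permutation.Propositional using (_↭_)
  open import Data.List.Relation.Binary.Permutation.Propositional.Properties using (∈-resp-↭; ↭-length)
  open import Data.Bool using (Bool; true; false; not; _∧_; if_then_else_)
  open import Data.Bool.Properties using (T-≡)
  open import Data.Product using (∃; _,_)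
  open import Function.Base using (id; _∘_)
  open import Function.Bundles using (Equivalence)
  open import Relation.Nullary using (yes; no)
  open import Relation.Nullary.Negation using (contradiction)
  open import Relation.Binary.PropositionalEquality

  private
    ≤ᵇ≡true⇒≤ : ∀ {a b} → (a ≤ᵇ b) ≡ true → a ≤ b
    ≤ᵇ≡true⇒≤ {a} {b} e = ≤ᵇ⇒≤ a b (Equivalence.from T-≡ e)

    ≤⇒≤ᵇ≡true : ∀ {a b} → a ≤ b → (a ≤ᵇ b) ≡ true
    ≤⇒≤ᵇ≡true a≤b = Equivalence.to T-≡ (≤⇒≤ᵇ a≤b)

    true≢false : true ≢ false
    true≢false ()

    exchange : ∀ a b c → a + (b + c) ≡ b + (a + c)
    exchange = solve-∀

    interchange : ∀ a b c e → (a + c) + (b + e) ≡ (a + b) + (c + e)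
    interchange = solve-∀

  χ≤ : ℕ → ℕ → ℕ
  χ≤ a b = if a ≤ᵇ b then 1 else 0

  module _ (D : ℕ) where

    count-unchanged : ∀ gs → count (λ g → (indicator g + D) == D) gs + count id gs ≡ length gs
    count-unchanged [] = refl
    count-unchanged (true ∷ gs) rewrite ≢⇒==-false {suc D} {D} 1+n≢n =
      trans (+-suc (count (λ g → (indicator g + D) == D) gs) _) (cong suc (count-unchanged gs))
    count-unchanged (false ∷ gs) rewrite ==-refl D = cong suc (count-unchanged gs)

    count-raised : ∀ gs → count (λ g → (indicator g + D) == suc D) gs ≡ count id gs
    count-raised [] = refl
    count-raised (true ∷ gs) rewrite ==-refl (suc D) = cong suc (count-raised gs)
    count-raised (false ∷ gs) rewrite ≢⇒==-false {D} {suc D} (1+n≢n ∘ sym) = count-raised gs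

    count-other : ∀ m gs → m ≢ D → m ≢ suc D → count (λ g → (indicator g + D) == m) gs ≡ 0
    count-other m [] _ _ = refl
    count-other m (true ∷ gs) m≢D m≢1+D rewrite ≢⇒==-false {suc D} {m} (m≢1+D ∘ sym) = count-other m gs m≢D m≢1+D
    count-other m (false ∷ gs) m≢D m≢1+D rewrite ≢⇒==-false {D} {m} (m≢D ∘ sym) = count-other m gs m≢D m≢1+D

  module _ (d N : ℕ) where

    private
      N+d≰ : ∀ {s} → s < N → (N + d ≤ᵇ s) ≢ true
      N+d≰ s<N e = <⇒≱ (<-≤-trans s<N (m≤m+n N d)) (≤ᵇ≡true⇒≤ e)

      y+d≤s⇒y+d≤N : ∀ {s} y → s < N → (y + d ≤ᵇ s) ≡ true → (y + d ≤ᵇ N) ≡ true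
      y+d≤s⇒y+d≤N {s} y s<N y+d≤s = ≤⇒≤ᵇ≡true (≤-trans (≤ᵇ≡true⇒≤ {y + d} {s} y+d≤s) (<⇒≤ s<N))

      insertAfterℕ-skip : ∀ x s ws → s ≢ x → insertAfterℕ x N (s ∷ ws) ≡ s ∷ insertAfterℕ x N ws
      insertAfterℕ-skip x s ws s≢x with s ℕ.≟ x
      ... | yes s≡x = contradiction s≡x s≢x
      ... | no _ = refl

      insertAfterℕ-hit : ∀ s ws → insertAfterℕ s N (s ∷ ws) ≡ s ∷ N ∷ insertAfterℕ s N ws
      insertAfterℕ-hit s ws with s ℕ.≟ s
      ... | yes _ = refl
      ... | no s≢s = contradiction refl s≢s

      insertAfterℕ-∉ : ∀ x ws → x ∉ ws → insertAfterℕ x N ws ≡ ws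
      insertAfterℕ-∉ x [] _ = refl
      insertAfterℕ-∉ x (s ∷ ws) x∉ =
        trans (insertAfterℕ-skip x s ws (λ s≡x → x∉ (here (sym s≡x)))) (cong (s ∷_) (insertAfterℕ-∉ x ws (x∉ ∘ there)))

      insertAfterℕ-head : ∀ x y r → ∃ λ tl → insertAfterℕ x N (y ∷ r) ≡ y ∷ tl
      insertAfterℕ-head x y r with y ℕ.≟ x
      ... | yes _ = _ , refl
      ... | no _ = _ , refl

    -- For adjacent letters s, y with s < N, putting N between them keeps a descent at s → y
    -- (as N → y) and creates one exactly when y + d ≤ N but not y + d ≤ s.
    gain : ℕ → ℕ → Bool
    gain s y = not (y + d ≤ᵇ s) ∧ (y + d ≤ᵇ N)

    gains : List ℕ → List Bool
    gains [] = []
    gains (s ∷ []) = false ∷ []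
    gains (s ∷ y ∷ r) = gain s y ∷ gains (y ∷ r)

    length-gains : ∀ w → length (gains w) ≡ length w
    length-gains [] = refl
    length-gains (s ∷ []) = refl
    length-gains (s ∷ y ∷ r) = cong suc (length-gains (y ∷ r))

    descents-insert-here : ∀ s y D → s < N → χ≤ (N + d) s + (χ≤ (y + d) N + D) ≡ indicator (gain s y) + (χ≤ (y + d) s + D)
    descents-insert-here s y D s<N with N + d ≤ᵇ s in N+d≤s | y + d ≤ᵇ s in y+d≤s | y + d ≤ᵇ N in y+d≤N
    ... | true  | _     | _     = contradiction N+d≤s (N+d≰ s<N)
    ... | false | true  | false = contradiction (trans (sym (y+d≤s⇒y+d≤N y s<N y+d≤s)) y+d≤N) true≢false
    ... | false | true  | true  = refl
    ... | false | false | true  = refl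
    ... | false | false | false = refl

    descents-insertAfterℕ : ∀ w → Unique w → All (_< N) w →
      map (λ x → dDescents d (insertAfterℕ x N w)) w ≡ map (λ g → indicator g + dDescents d w) (gains w)
    descents-insertAfterℕ [] _ _ = refl
    descents-insertAfterℕ (s ∷ []) _ (s<N ∷ []) rewrite insertAfterℕ-hit s [] with N + d ≤ᵇ s in N+d≤s
    ... | true = contradiction N+d≤s (N+d≰ s<N)
    ... | false = refl
    descents-insertAfterℕ (s ∷ y ∷ r) (s≢yr Unique.∷ yr!) (s<N ∷ yr<N) = cong₂ _∷_ at-s after-s
      where
      at-s : dDescents d (insertAfterℕ s N (s ∷ y ∷ r)) ≡ indicator (gain s y) + dDescents d (s ∷ y ∷ r)
      at-s rewrite insertAfterℕ-hit s (y ∷ r) | insertAfterℕ-∉ s (y ∷ r) (λ s∈ → All.lookup s≢yr s∈ refl) =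
        descents-insert-here s y (dDescents d (y ∷ r)) s<N
      skip-s : ∀ x → s ≢ x → dDescents d (insertAfterℕ x N (s ∷ y ∷ r)) ≡ χ≤ (y + d) s + dDescents d (insertAfterℕ x N (y ∷ r))
      skip-s x s≢x with insertAfterℕ-head x y r
      ... | tl , e rewrite insertAfterℕ-skip x s (y ∷ r) s≢x | e = refl
      after-s : map (λ x → dDescents d (insertAfterℕ x N (s ∷ y ∷ r))) (y ∷ r)
              ≡ map (λ g → indicator g + dDescents d (s ∷ y ∷ r)) (gains (y ∷ r))
      after-s = begin
        map (λ x → dDescents d (insertAfterℕ x N (s ∷ y ∷ r))) (y ∷ r)
          ≡⟨ map-cong-local (All.map (λ {x} → skip-s x) s≢yr) ⟩
        map (λ x → χ≤ (y + d) s + dDescents d (insertAfterℕ x N (y ∷ r))) (y ∷ r)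
          ≡⟨ map-∘ (y ∷ r) ⟩
        map (χ≤ (y + d) s +_) (map (λ x → dDescents d (insertAfterℕ x N (y ∷ r))) (y ∷ r))
          ≡⟨ cong (map _) (descents-insertAfterℕ (y ∷ r) yr! yr<N) ⟩
        map (χ≤ (y + d) s +_) (map (λ g → indicator g + dDescents d (y ∷ r)) (gains (y ∷ r)))
          ≡⟨ map-∘ (gains (y ∷ r)) ⟨
        map (λ g → χ≤ (y + d) s + (indicator g + dDescents d (y ∷ r))) (gains (y ∷ r))
          ≡⟨ map-cong (λ g → exchange (χ≤ (y + d) s) (indicator g) _) (gains (y ∷ r)) ⟩
        map (λ g → indicator g + dDescents d (s ∷ y ∷ r)) (gains (y ∷ r)) ∎
        where open ≡-Reasoning

    descents-∷ʳ-N : ∀ w → All (_< N) w → dDescents d (w ++ N ∷ []) ≡ dDescents d w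
    descents-∷ʳ-N [] _ = refl
    descents-∷ʳ-N (s ∷ []) (s<N ∷ _) with N + d ≤ᵇ s in N+d≤s
    ... | true = contradiction N+d≤s (N+d≰ s<N)
    ... | false = refl
    descents-∷ʳ-N (s ∷ y ∷ r) (_ ∷ yr<N) = cong (χ≤ (y + d) s +_) (descents-∷ʳ-N (y ∷ r) yr<N)

    lowCount : List ℕ → ℕ
    lowCount w = count (λ y → y + d ≤ᵇ N) (drop 1 w)

    count-gains+descents : ∀ w → All (_< N) w → count id (gains w) + dDescents d w ≡ lowCount w
    count-gains+descents [] _ = refl
    count-gains+descents (s ∷ []) _ = refl
    count-gains+descents (s ∷ y ∷ r) (s<N ∷ yr<N) =
      trans (interchange (indicator (gain s y)) (χ≤ (y + d) s) (count id (gains (y ∷ r))) (dDescents d (y ∷ r)))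
            (cong₂ _+_ gain+descent (count-gains+descents (y ∷ r) yr<N))
      where
      gain+descent : indicator (gain s y) + χ≤ (y + d) s ≡ indicator (y + d ≤ᵇ N)
      gain+descent with y + d ≤ᵇ s in y+d≤s | y + d ≤ᵇ N in y+d≤N
      ... | true | false = contradiction (trans (sym (y+d≤s⇒y+d≤N y s<N y+d≤s)) y+d≤N) true≢false
      ... | true | true = refl
      ... | false | true = refl
      ... | false | false = refl

    module PermutationWord (1≤d : 1 ≤ d) (d≤N : d ≤ N) {w ws : List ℕ}
                           (w! : Unique w) (w↭upTo : w ↭ L.upTo N) (w≡0∷ws : w ≡ 0 ∷ ws) where

      D : ℕ
      D = dDescents d w

      private
        small? : ℕ → Bool
        small? y = y + d ≤ᵇ N

        M : ℕ
        M = suc (N ∸ d)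

        count-small-upTo-≤ : ∀ K → K ≤ M → count small? (L.upTo K) ≡ K
        count-small-upTo-≤ zero _ = refl
        count-small-upTo-≤ (suc K) K<M = begin
          count small? (L.upTo (suc K))
            ≡⟨ cong (count small?) (upTo-∷ʳ K) ⟨
          count small? (L.upTo K ++ K ∷ [])
            ≡⟨ count-++ small? (L.upTo K) _ ⟩
          count small? (L.upTo K) + (indicator (small? K) + 0)
            ≡⟨ cong₂ (λ a b → a + (indicator b + 0)) (count-small-upTo-≤ K (<⇒≤ K<M)) (≤⇒≤ᵇ≡true K+d≤N) ⟩
          K + 1
            ≡⟨ +-comm K 1 ⟩
          suc K ∎
          where
          open ≡-Reasoning
          K+d≤N : K + d ≤ N
          K+d≤N = subst (K + d ≤_) (m∸n+n≡m d≤N) (+-monoˡ-≤ d (≤-pred K<M))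

        count-small-upTo-M+ : ∀ j → count small? (L.upTo (M + j)) ≡ M
        count-small-upTo-M+ zero = trans (cong (count small? ∘ L.upTo) (+-identityʳ M)) (count-small-upTo-≤ M ≤-refl)
        count-small-upTo-M+ (suc j) = begin
          count small? (L.upTo (M + suc j))
            ≡⟨ cong (count small? ∘ L.upTo) (+-suc M j) ⟩
          count small? (L.upTo (suc (M + j)))
            ≡⟨ cong (count small?) (upTo-∷ʳ (M + j)) ⟨
          count small? (L.upTo (M + j) ++ M + j ∷ [])
            ≡⟨ count-++ small? (L.upTo (M + j)) _ ⟩
          count small? (L.upTo (M + j)) + (indicator (small? (M + j)) + 0)
            ≡⟨ cong₂ (λ a b → a + (indicator b + 0)) (count-small-upTo-M+ j) not-small ⟩
          M + 0
            ≡⟨ +-identityʳ M ⟩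
          M ∎
          where
          open ≡-Reasoning
          not-small : small? (M + j) ≡ false
          not-small with small? (M + j) in e
          ... | true = contradiction (≤ᵇ≡true⇒≤ e) (<⇒≱ (subst (_< M + j + d) (m∸n+n≡m d≤N) (+-monoˡ-< d (m≤m+n M j))))
          ... | false = refl

        count-small-upTo : count small? (L.upTo N) ≡ M
        count-small-upTo = trans (cong (count small? ∘ L.upTo) (sym M+[d-1]≡N)) (count-small-upTo-M+ (d ∸ 1))
          where
          M+[d-1]≡N : M + (d ∸ 1) ≡ N
          M+[d-1]≡N = trans (sym (+-suc (N ∸ d) (d ∸ 1))) (trans (cong (N ∸ d +_) (m+[n∸m]≡n 1≤d)) (m∸n+n≡m d≤N))

        w<N : All (_< N) w
        w<N = All.tabulate (λ y∈w → ∈-upTo⁻ (∈-resp-↭ w↭upTo y∈w))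

        lowCount-w : lowCount w ≡ N ∸ d
        lowCount-w = suc-injective (begin
          suc (lowCount w)       ≡⟨ cong (suc ∘ lowCount) w≡0∷ws ⟩
          suc (count small? ws)  ≡⟨ cong (λ b → indicator b + count small? ws) (≤⇒≤ᵇ≡true d≤N) ⟨
          count small? (0 ∷ ws)  ≡⟨ cong (count small?) w≡0∷ws ⟨
          count small? w         ≡⟨ count-↭ small? w↭upTo ⟩
          count small? (L.upTo N) ≡⟨ count-small-upTo ⟩
          M                      ∎)
          where open ≡-Reasoning

        count-insert : ∀ m → count (λ x → dDescents d (insertAfterℕ x N w) == m) w ≡ count (λ g → (indicator g + D) == m) (gains w)
        count-insert m = begin
          count (λ x → dDescents d (insertAfterℕ x N w) == m) w            ≡⟨ count-map (_== m) _ w ⟨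
          count (_== m) (map (λ x → dDescents d (insertAfterℕ x N w)) w)   ≡⟨ cong (count (_== m)) (descents-insertAfterℕ w w! w<N) ⟩
          count (_== m) (map (λ g → indicator g + D) (gains w))            ≡⟨ count-map (_== m) _ (gains w) ⟩
          count (λ g → (indicator g + D) == m) (gains w)                   ∎
          where open ≡-Reasoning

      gainCount : ℕ
      gainCount = count id (gains w)

      gainCount+descents+d : gainCount + D + d ≡ N
      gainCount+descents+d = trans (cong (_+ d) (trans (count-gains+descents w w<N) lowCount-w)) (m∸n+n≡m d≤N)

      count-insert-unchanged : count (λ x → dDescents d (insertAfterℕ x N w) == D) w ≡ D + d
      count-insert-unchanged = +-cancelʳ-≡ gainCount _ _ (begin
        count (λ x → dDescents d (insertAfterℕ x N w) == D) w + gainCount ≡⟨ cong (_+ gainCount) (count-insert D) ⟩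
        count (λ g → (indicator g + D) == D) (gains w) + gainCount        ≡⟨ count-unchanged D (gains w) ⟩
        length (gains w)                                                 ≡⟨ length-gains w ⟩
        length w                                                         ≡⟨ trans (↭-length w↭upTo) (length-upTo N) ⟩
        N                                                                ≡⟨ gainCount+descents+d ⟨
        gainCount + D + d                                                ≡⟨ +-assoc gainCount D d ⟩
        gainCount + (D + d)                                              ≡⟨ +-comm gainCount (D + d) ⟩
        D + d + gainCount                                                ∎)
        where open ≡-Reasoning

      count-insert-raised : count (λ x → dDescents d (insertAfterℕ x N w) == suc D) w ≡ gainCount
      count-insert-raised = trans (count-insert (suc D)) (count-raised D (gains w))

      count-insert-other : ∀ m → m ≢ D → m ≢ suc D → count (λ x → dDescents d (insertAfterℕ x N w) == m) w ≡ 0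
      count-insert-other m m≢D m≢1+D = trans (count-insert m) (count-other D m (gains w) m≢D m≢1+D)

      descents-w∷ʳN : dDescents d (w ++ N ∷ []) ≡ D
      descents-w∷ʳN = descents-∷ʳ-N w w<N


module Recurrence where

  open import Defs
  open Counting
  open FinEndomaps
  open Insertion
  open PermutationEnumeration
  open ProfileCount
  open InsertionCycles
  open FlattenInsertion
  open FlattenPermutation
  open DescentGain
  open import Data.Nat as ℕ using (ℕ; zero; suc; _≤_)
  open import Data.Nat.Properties using (1+n≢n; +-identityʳ)
  open import Data.Integer using (ℤ; +_; -[1+_]; _+_; _-_; _*_)
  open import Data.Integer.Properties using (pos-+; *-zeroʳ; *-distribˡ-+; +-identityˡ)
  open import Data.Integer.Tactic.RingSolver using (solve-∀)
  open import Data.Fin as Fin using (Fin; toℕ; inject₁; fromℕ)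
  open import Data.Vec using (Vec; lookup)
  open import Data.List as L using (List; []; _∷_; _++_; map)
  open import Data.List.Properties using (map-tabulate; map-∘; map-applyUpTo)
  open import Data.List.Membership.Propositional using (_∈_)
  open import Data.List.Relation.Unary.Any using (here; there)
  open import Data.List.Relation.Binary.Permutation.Propositional using (↭-sym)
  open import Data.Bool using (Bool; true; false; _∧_)
  open import Data.Bool.Properties using (∧-identityʳ; ∧-zeroʳ)
  open import Data.Product using (_,_; proj₂)
  open import Function.Base using (_∘_)
  open import Relation.Nullary using (Dec; yes; no)
  open import Relation.Binary.PropositionalEquality

  profileℤ : ∀ {n} → ℕ → (Fin n → Fin n) → ℤ → ℕ → ℤ
  profileℤ d σ (+ m) k = + indicator (hasProfile d m k σ)
  profileℤ d σ -[1+ _ ] k = + 0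

  private
    map-toℕ-allFin : ∀ n → map toℕ (L.allFin n) ≡ L.upTo n
    map-toℕ-allFin zero = refl
    map-toℕ-allFin (suc n) = cong (0 ∷_) (begin
      map toℕ (L.tabulate Fin.suc)        ≡⟨ cong (map toℕ) (map-tabulate (λ x → x) Fin.suc) ⟨
      map toℕ (map Fin.suc (L.allFin n))  ≡⟨ map-∘ (L.allFin n) ⟨
      map (suc ∘ toℕ) (L.allFin n)        ≡⟨ map-∘ (L.allFin n) ⟩
      map suc (map toℕ (L.allFin n))      ≡⟨ cong (map suc) (map-toℕ-allFin n) ⟩
      map suc (L.upTo n)                  ≡⟨ map-applyUpTo (λ x → x) suc n ⟩
      L.applyUpTo suc n                   ∎)
      where open ≡-Reasoning

    count-allFin-suc : ∀ {n} (q : Fin (suc n) → Bool) →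
      count q (L.allFin (suc n)) ≡ count (q ∘ inject₁) (L.allFin n) ℕ.+ (indicator (q (fromℕ n)) ℕ.+ 0)
    count-allFin-suc {n} q = begin
      count q (L.allFin (suc n))
        ≡⟨ cong (count q) (allFin-∷ʳ n) ⟩
      count q (map inject₁ (L.allFin n) ++ fromℕ n ∷ [])
        ≡⟨ count-++ q (map inject₁ (L.allFin n)) _ ⟩
      count q (map inject₁ (L.allFin n)) ℕ.+ (indicator (q (fromℕ n)) ℕ.+ 0)
        ≡⟨ cong (ℕ._+ (indicator (q (fromℕ n)) ℕ.+ 0)) (count-map q inject₁ (L.allFin n)) ⟩
      count (q ∘ inject₁) (L.allFin n) ℕ.+ (indicator (q (fromℕ n)) ℕ.+ 0) ∎
      where open ≡-Reasoning

    no-change : ∀ (X A B : ℤ) → X ≡ X + A * + 0 + B * + 0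
    no-change = solve-∀

    unchanged : ∀ (D d B : ℤ) → D + d ≡ + 0 + (D + d) * + 1 + B * + 0
    unchanged = solve-∀

    raised : ∀ (S D d A : ℤ) → S ≡ + 0 + A * + 0 + (+ 1 + (S + D + d) - (+ 1 + D) - d) * + 1
    raised = solve-∀

  module InsertionCount (d : ℕ) (1≤d : 1 ≤ d) {n : ℕ} (d≤n : d ≤ n) (σ : Fin n → Fin n) (σ-surj : Surj σ)
                        {ws : List ℕ} (w≡0∷ws : flatten σ ≡ 0 ∷ ws) (k : ℕ) where

    private
      w = flatten σ
      c = numCycles σ
      open PermutationWord d n 1≤d d≤n (flatten-unique σ σ-surj) (flatten-↭-upTo σ σ-surj) w≡0∷ws

    insertions : ℕ → ℕ
    insertions m = count (λ j → hasProfile d m (suc k) (insert σ j)) (L.allFin (suc n))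

    private
      hasProfile-insertAfter : ∀ m x →
        hasProfile d m (suc k) (insert σ (inject₁ x)) ≡ (dDescents d (insertAfterℕ (toℕ x) n w) == m) ∧ (c == suc k)
      hasProfile-insertAfter m x =
        cong₂ (λ u v → (dDescents d u == m) ∧ (v == suc k)) (flatten-insertAfter σ σ-surj x) (numCycles-insertAfter σ σ-surj x)

      hasProfile-insertFixed : ∀ m → hasProfile d m (suc k) (insert σ (fromℕ n)) ≡ hasProfile d m k σ
      hasProfile-insertFixed m = cong₂ (λ u v → (u == m) ∧ v)
        (trans (cong (dDescents d) (flatten-insertFixed σ σ-surj)) descents-w∷ʳN)
        (trans (cong (_== suc k) (numCycles-insertFixed σ σ-surj)) (==-suc c k))

      insertions-split : ∀ m → insertions m ≡
        count (λ x → (dDescents d (insertAfterℕ (toℕ x) n w) == m) ∧ (c == suc k)) (L.allFin n) ℕ.+ (indicator (hasProfile d m k σ) ℕ.+ 0)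
      insertions-split m = trans (count-allFin-suc (λ j → hasProfile d m (suc k) (insert σ j)))
        (cong₂ (λ u b → u ℕ.+ (indicator b ℕ.+ 0)) (count-cong _ _ (L.allFin n) (λ x _ → hasProfile-insertAfter m x)) (hasProfile-insertFixed m))

      insertAfter-count : ∀ m → (c == suc k) ≡ true →
        count (λ x → (dDescents d (insertAfterℕ (toℕ x) n w) == m) ∧ (c == suc k)) (L.allFin n) ≡
        count (λ y → dDescents d (insertAfterℕ y n w) == m) w
      insertAfter-count m c≡1+k = begin
        count (λ x → (dDescents d (insertAfterℕ (toℕ x) n w) == m) ∧ (c == suc k)) (L.allFin n)
          ≡⟨ count-cong _ _ (L.allFin n) (λ x _ → trans (cong (_ ∧_) c≡1+k) (∧-identityʳ _)) ⟩
        count ((λ y → dDescents d (insertAfterℕ y n w) == m) ∘ toℕ) (L.allFin n)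
          ≡⟨ count-map _ toℕ (L.allFin n) ⟨
        count (λ y → dDescents d (insertAfterℕ y n w) == m) (map toℕ (L.allFin n))
          ≡⟨ cong (count _) (map-toℕ-allFin n) ⟩
        count (λ y → dDescents d (insertAfterℕ y n w) == m) (L.upTo n)
          ≡⟨ count-↭ _ (↭-sym (flatten-↭-upTo σ σ-surj)) ⟩
        count (λ y → dDescents d (insertAfterℕ y n w) == m) w ∎
        where open ≡-Reasoning

      profileℤ-other : ∀ k′ → (c == k′) ≡ false → ∀ m → profileℤ d σ m k′ ≡ + 0
      profileℤ-other k′ c≢k′ (+ m) = cong (+_ ∘ indicator) (trans (cong (_ ∧_) c≢k′) (∧-zeroʳ _))
      profileℤ-other k′ c≢k′ -[1+ _ ] = refl

      profileℤ-same : (c == suc k) ≡ true → ∀ m → profileℤ d σ (+ m) (suc k) ≡ + indicator (D == m)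
      profileℤ-same c≡1+k m = cong (+_ ∘ indicator) (trans (cong (_ ∧_) c≡1+k) (∧-identityʳ _))

      profileℤ-pred : (c == suc k) ≡ true → ∀ m → (∀ m′ → m ≡ suc m′ → D ≢ m′) → profileℤ d σ (+ m - + 1) (suc k) ≡ + 0
      profileℤ-pred c≡1+k zero _ = refl
      profileℤ-pred c≡1+k (suc m′) D≢m′ = trans (profileℤ-same c≡1+k m′) (cong (+_ ∘ indicator) (≢⇒==-false (D≢m′ m′ refl)))

      module SameCycles (c≡1+k : c ≡ suc k) where

        c==1+k : (c == suc k) ≡ true
        c==1+k = trans (cong (_== suc k) c≡1+k) (==-refl (suc k))

        c==k : (c == k) ≡ false
        c==k = ≢⇒==-false (λ c≡k → 1+n≢n (trans (sym c≡1+k) c≡k))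

        insertions≡ : ∀ m → insertions m ≡ count (λ y → dDescents d (insertAfterℕ y n w) == m) w
        insertions≡ m = trans (insertions-split m)
          (trans (cong₂ (λ u b → u ℕ.+ (indicator b ℕ.+ 0)) (insertAfter-count m c==1+k) (trans (cong (_ ∧_) c==k) (∧-zeroʳ _)))
                 (+-identityʳ _))

      rhs : ℕ → ℤ
      rhs m = profileℤ d σ (+ m) k + (+ m + + d) * profileℤ d σ (+ m) (suc k) + (+ suc n - + m - + d) * profileℤ d σ (+ m - + 1) (suc k)

      rhs≡ : ∀ m {p q r} → profileℤ d σ (+ m) k ≡ p → profileℤ d σ (+ m) (suc k) ≡ q → profileℤ d σ (+ m - + 1) (suc k) ≡ r →
        rhs m ≡ p + (+ m + + d) * q + (+ suc n - + m - + d) * r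
      rhs≡ m p q r = cong₂ _+_ (cong₂ (λ u v → u + (+ m + + d) * v) p q) (cong ((+ suc n - + m - + d) *_) r)

      recurrence-other-cycles : c ≢ suc k → ∀ m → + insertions m ≡ rhs m
      recurrence-other-cycles c≢1+k m = begin
        + insertions m
          ≡⟨ cong +_ (insertions-split m) ⟩
        + (count _ (L.allFin n) ℕ.+ (indicator (hasProfile d m k σ) ℕ.+ 0))
          ≡⟨ cong (λ u → + (u ℕ.+ (indicator (hasProfile d m k σ) ℕ.+ 0)))
                  (trans (count-cong _ _ (L.allFin n) (λ x _ → trans (cong (_ ∧_) c==1+k) (∧-zeroʳ _))) (count-false (L.allFin n))) ⟩
        + (indicator (hasProfile d m k σ) ℕ.+ 0)
          ≡⟨ cong +_ (+-identityʳ _) ⟩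
        profileℤ d σ (+ m) k
          ≡⟨ no-change (profileℤ d σ (+ m) k) (+ m + + d) (+ suc n - + m - + d) ⟩
        profileℤ d σ (+ m) k + (+ m + + d) * + 0 + (+ suc n - + m - + d) * + 0
          ≡⟨ rhs≡ m refl (profileℤ-other (suc k) c==1+k (+ m)) (profileℤ-other (suc k) c==1+k (+ m - + 1)) ⟨
        rhs m ∎
        where
        open ≡-Reasoning
        c==1+k = ≢⇒==-false c≢1+k

      recurrence-same-cycles : c ≡ suc k → ∀ m → Dec (m ≡ D) → Dec (m ≡ suc D) → + insertions m ≡ rhs m
      recurrence-same-cycles c≡1+k .D (yes refl) _ = begin
        + insertions D
          ≡⟨ cong +_ (trans (insertions≡ D) count-insert-unchanged) ⟩
        + D + + d
          ≡⟨ unchanged (+ D) (+ d) (+ suc n - + D - + d) ⟩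
        + 0 + (+ D + + d) * + 1 + (+ suc n - + D - + d) * + 0
          ≡⟨ rhs≡ D (profileℤ-other k c==k (+ D))
                    (trans (profileℤ-same c==1+k D) (cong (+_ ∘ indicator) (==-refl D)))
                    (profileℤ-pred c==1+k D (λ m′ D≡1+m′ D≡m′ → 1+n≢n (trans (sym D≡1+m′) D≡m′))) ⟨
        rhs D ∎
        where
        open ≡-Reasoning
        open SameCycles c≡1+k
      recurrence-same-cycles c≡1+k .(suc D) (no _) (yes refl) = begin
        + insertions (suc D)
          ≡⟨ cong +_ (trans (insertions≡ (suc D)) count-insert-raised) ⟩
        + gainCount
          ≡⟨ raised (+ gainCount) (+ D) (+ d) (+ suc D + + d) ⟩
        + 0 + (+ suc D + + d) * + 0 + (+ suc (gainCount ℕ.+ D ℕ.+ d) - + suc D - + d) * + 1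
          ≡⟨ cong (λ N′ → + 0 + (+ suc D + + d) * + 0 + (+ suc N′ - + suc D - + d) * + 1) gainCount+descents+d ⟩
        + 0 + (+ suc D + + d) * + 0 + (+ suc n - + suc D - + d) * + 1
          ≡⟨ rhs≡ (suc D) (profileℤ-other k c==k (+ suc D))
                          (trans (profileℤ-same c==1+k (suc D)) (cong (+_ ∘ indicator) (≢⇒==-false (1+n≢n ∘ sym))))
                          (trans (profileℤ-same c==1+k D) (cong (+_ ∘ indicator) (==-refl D))) ⟨
        rhs (suc D) ∎
        where
        open ≡-Reasoning
        open SameCycles c≡1+k
      recurrence-same-cycles c≡1+k m (no m≢D) (no m≢1+D) = begin
        + insertions m
          ≡⟨ cong +_ (trans (insertions≡ m) (count-insert-other m m≢D m≢1+D)) ⟩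
        + 0
          ≡⟨ no-change (+ 0) (+ m + + d) (+ suc n - + m - + d) ⟩
        + 0 + (+ m + + d) * + 0 + (+ suc n - + m - + d) * + 0
          ≡⟨ rhs≡ m (profileℤ-other k c==k (+ m))
                    (trans (profileℤ-same c==1+k m) (cong (+_ ∘ indicator) (≢⇒==-false (m≢D ∘ sym))))
                    (profileℤ-pred c==1+k m (λ m′ m≡1+m′ D≡m′ → m≢1+D (trans m≡1+m′ (cong suc (sym D≡m′))))) ⟨
        rhs m ∎
        where
        open ≡-Reasoning
        open SameCycles c≡1+k

    insertions-recurrence : ∀ m → + insertions m ≡
      profileℤ d σ (+ m) k + (+ m + + d) * profileℤ d σ (+ m) (suc k) + (+ suc n - + m - + d) * profileℤ d σ (+ m - + 1) (suc k)
    insertions-recurrence m = by-cycles (c ℕ.≟ suc k)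
      where
      -- A helper rather than `with`, which would also abstract this test inside profileℤ.
      by-cycles : Dec (c ≡ suc k) → + insertions m ≡ rhs m
      by-cycles (no c≢1+k) = recurrence-other-cycles c≢1+k m
      by-cycles (yes c≡1+k) = recurrence-same-cycles c≡1+k m (m ℕ.≟ D) (m ℕ.≟ suc D)


  private
    sumℤ : ∀ {A : Set} → (A → ℤ) → List A → ℤ
    sumℤ f [] = + 0
    sumℤ f (x ∷ xs) = f x + sumℤ f xs

    module _ {A : Set} where

      +sumBy≡sumℤ : (f : A → ℕ) (xs : List A) → + sumBy f xs ≡ sumℤ (+_ ∘ f) xs
      +sumBy≡sumℤ f [] = refl
      +sumBy≡sumℤ f (x ∷ xs) = trans (pos-+ (f x) (sumBy f xs)) (cong (λ r → + f x + r) (+sumBy≡sumℤ f xs))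

      sumℤ-cong : (f g : A → ℤ) (xs : List A) → (∀ x → x ∈ xs → f x ≡ g x) → sumℤ f xs ≡ sumℤ g xs
      sumℤ-cong f g [] h = refl
      sumℤ-cong f g (x ∷ xs) h = cong₂ _+_ (h x (here refl)) (sumℤ-cong f g xs (λ y m → h y (there m)))

      sumℤ-+ : (f g : A → ℤ) (xs : List A) → sumℤ (λ x → f x + g x) xs ≡ sumℤ f xs + sumℤ g xs
      sumℤ-+ f g [] = refl
      sumℤ-+ f g (x ∷ xs) = trans (cong (λ r → f x + g x + r) (sumℤ-+ f g xs)) (interchange (f x) (g x) _ _)
        where interchange : ∀ (a b c e : ℤ) → (a + b) + (c + e) ≡ (a + c) + (b + e)
              interchange = solve-∀

      sumℤ-* : (c : ℤ) (f : A → ℤ) (xs : List A) → sumℤ (λ x → c * f x) xs ≡ c * sumℤ f xs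
      sumℤ-* c f [] = sym (*-zeroʳ c)
      sumℤ-* c f (x ∷ xs) = trans (cong (λ r → c * f x + r) (sumℤ-* c f xs)) (sym (*-distribˡ-+ c (f x) _))

      sumℤ-linear : (f g h : A → ℤ) (b c : ℤ) (xs : List A) →
        sumℤ (λ x → f x + b * g x + c * h x) xs ≡ sumℤ f xs + b * sumℤ g xs + c * sumℤ h xs
      sumℤ-linear f g h b c xs = begin
        sumℤ (λ x → f x + b * g x + c * h x) xs                  ≡⟨ sumℤ-+ (λ x → f x + b * g x) (λ x → c * h x) xs ⟩
        sumℤ (λ x → f x + b * g x) xs + sumℤ (λ x → c * h x) xs  ≡⟨ cong₂ _+_ (sumℤ-+ f (λ x → b * g x) xs) (sumℤ-* c h xs) ⟩
        sumℤ f xs + sumℤ (λ x → b * g x) xs + c * sumℤ h xs      ≡⟨ cong (λ r → sumℤ f xs + r + c * sumℤ h xs) (sumℤ-* b g xs) ⟩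
        sumℤ f xs + b * sumℤ g xs + c * sumℤ h xs                ∎
        where open ≡-Reasoning

      sumℤ-0 : (xs : List A) → sumℤ (λ _ → + 0) xs ≡ + 0
      sumℤ-0 [] = refl
      sumℤ-0 (x ∷ xs) = trans (+-identityˡ _) (sumℤ-0 xs)

  sumℤ-profileℤ : ∀ d n m k → sumℤ (λ v → profileℤ d (lookup v) m k) (perms n) ≡ aℤ d n m k
  sumℤ-profileℤ d n (+ m) k = sym (trans (cong +_ (trans (a≡count d n m k) (count≡sumBy _ (perms n)))) (+sumBy≡sumℤ _ (perms n)))
  sumℤ-profileℤ d n -[1+ _ ] k = sumℤ-0 (perms n)

  recurrence : ∀ d → 1 ≤ d → ∀ n k m → d ≤ suc n →
    + a d (suc (suc n)) m (suc k) ≡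
      + a d (suc n) m k + (+ m + + d) * + a d (suc n) m (suc k) + (+ suc (suc n) - + m - + d) * aℤ d (suc n) (+ m - + 1) (suc k)
  recurrence d 1≤d n k m d≤1+n = begin
    + a d (suc (suc n)) m (suc k)
      ≡⟨ cong +_ (a-suc≡sum-insert d (suc n) m (suc k)) ⟩
    + sumBy (λ v → count (λ j → hasProfile d m (suc k) (insert (lookup v) j)) (L.allFin (suc (suc n)))) (perms (suc n))
      ≡⟨ +sumBy≡sumℤ _ (perms (suc n)) ⟩
    sumℤ (λ v → + count (λ j → hasProfile d m (suc k) (insert (lookup v) j)) (L.allFin (suc (suc n)))) (perms (suc n))
      ≡⟨ sumℤ-cong _ _ (perms (suc n)) (λ v v∈perms → InsertionCount.insertions-recurrence d 1≤d d≤1+n (lookup v) (∈perms⁻ v∈perms)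
                                                         (proj₂ (flatten-starts-0 (lookup v))) k m) ⟩
    sumℤ (λ v → P v k + A * P v (suc k) + B * Q v) (perms (suc n))
      ≡⟨ sumℤ-linear (λ v → P v k) (λ v → P v (suc k)) Q A B (perms (suc n)) ⟩
    sumℤ (λ v → P v k) (perms (suc n)) + A * sumℤ (λ v → P v (suc k)) (perms (suc n)) + B * sumℤ Q (perms (suc n))
      ≡⟨ cong₂ _+_ (cong₂ (λ u v → u + A * v) (sumℤ-profileℤ d (suc n) (+ m) k) (sumℤ-profileℤ d (suc n) (+ m) (suc k)))
                   (cong (B *_) (sumℤ-profileℤ d (suc n) (+ m - + 1) (suc k))) ⟩
    + a d (suc n) m k + A * + a d (suc n) m (suc k) + B * aℤ d (suc n) (+ m - + 1) (suc k) ∎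
    where
    open ≡-Reasoning
    A = + m + + d
    B = + suc (suc n) - + m - + d
    P : Vec (Fin (suc n)) (suc n) → ℕ → ℤ
    P v k′ = profileℤ d (lookup v) (+ m) k′
    Q : Vec (Fin (suc n)) (suc n) → ℤ
    Q v = profileℤ d (lookup v) (+ m - + 1) (suc k)


open import Defs
open import Data.Nat using (ℕ; _≤_; _∸_; s≤s)
open import Data.Integer using (ℤ; +_; _+_; _-_; _*_)
open import Relation.Binary.PropositionalEquality using (_≡_; subst)
open import Data.Nat.Properties using (≤-pred; +-suc; m+n≤o⇒m≤o; m+n≤o⇒n≤o)
open Recurrence using (recurrence)

proposition2p6 : (d : ℕ) → 1 ≤ d → (n k m : ℕ) → d Data.Nat.+ 3 ≤ n → 1 ≤ k →
    + a d n m k ≡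
      + a d (n ∸ 1) m (k ∸ 1)
      + (+ m + + d) * + a d (n ∸ 1) m k
      + (+ n - + m - + d) * aℤ d (n ∸ 1) (+ m - + 1) k
proposition2p6 d 1≤d n k m d+3≤n 1≤k with m+n≤o⇒n≤o d d+3≤n | 1≤k
... | s≤s (s≤s (s≤s _)) | s≤s _ = recurrence d 1≤d _ _ m (m+n≤o⇒m≤o d (≤-pred (subst (_≤ n) (+-suc d 2) d+3≤n)))
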